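{- Let $N$ be a positive integer, $b_1,\dots,b_N\in\mathbb{Q}$ with $b_N\neq0$, and $k_1,\dots,k_N\in\mathbb{N}$. Then the coefficient of $x_1^{k_1}\cdots x_N^{k_N}$ in \[(1+x_1)^{b_1}(1+x_1+x_2)^{b_2}\cdots(1+x_1+\dots+x_N)^{b_N}\] equals \[\binom{b_N}{k_N}\binom{b_{N-1}+b_N-k_N}{k_{N-1}}\cdots\binom{b_1+\dots+b_N-k_N-\dots-k_2}{k_1},\] i.e. $\prod_{j=1}^{N}\binom{b_j+\dots+b_N-k_N-\dots-k_{j+1}}{k_j}$.
   Context: For $a\in\mathbb{Q}$ and $j\in\mathbb{N}$, $\binom{a}{j}=a(a-1)\cdots(a-j+1)/j!$. For a power series $L$ with zero constant term, $(1+L)^a:=\sum_{j\ge0}\binom{a}{j}L^j$, a formal power series with rational coefficients. -}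

module Defs where

open import Data.Nat as ℕ using (ℕ; zero; suc; _!; _≤ᵇ_)
open import Data.Nat.Properties using (_!≢0)
open import Data.Integer using (+_)
open import Data.Rational using (ℚ; 0ℚ; 1ℚ; _+_; _*_; _-_; _/_)
open import Data.Fin using (Fin; toℕ)
open import Data.Vec using (Vec; []; _∷_; tabulate; replicate)
open import Data.Vec.Properties using (≡-dec)
open import Data.List using (List; []; _∷_; map; foldr; concatMap; upTo; filter)
import Data.List as List
open import Data.Product using (_×_; _,_)
open import Data.Bool using (Bool; true; false; if_then_else_)
open import Relation.Nullary.Decidable using (does)
import Data.Nat.Properties as ℕₚ

ℕ→ℚ : ℕ → ℚ
ℕ→ℚ n = + n / 1

falling : ℚ → ℕ → ℚ
falling a zero    = 1ℚ
falling a (suc j) = falling a j * (a - ℕ→ℚ j)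

binom : ℚ → ℕ → ℚ
binom a j = falling a j * ((+ 1 / (j !)) {{j !≢0}})

sumℚ : List ℚ → ℚ
sumℚ = foldr _+_ 0ℚ

-- Formal power series in N variables x_0,...,x_{N-1} with rational
-- coefficients, given by their coefficient function on exponent vectors.
Mono : ℕ → Set
Mono N = Vec ℕ N

PS : ℕ → Set
PS N = Mono N → ℚ

splits : ∀ {N} → Mono N → List (Mono N × Mono N)
splits []       = (([] , []) ∷ [])
splits (k ∷ ks) =
  concatMap (λ i → map (λ { (m , n) → ((i ∷ m) , ((k ℕ.∸ i) ∷ n)) }) (splits ks))
            (upTo (suc k))

deg : ∀ {N} → Mono N → ℕ
deg []       = 0
deg (k ∷ ks) = k ℕ.+ deg ks

zeroMono : ∀ {N} → Mono N
zeroMono = replicate _ 0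

unitMono : ∀ {N} → Fin N → Mono N
unitMono i = tabulate (λ j → if does (toℕ i ℕ.≟ toℕ j) then 1 else 0)

oneS : ∀ {N} → PS N
oneS k = if does (≡-dec ℕ._≟_ k zeroMono) then 1ℚ else 0ℚ

var : ∀ {N} → Fin N → PS N
var i k = if does (≡-dec ℕ._≟_ k (unitMono i)) then 1ℚ else 0ℚ

_⊕_ : ∀ {N} → PS N → PS N → PS N
(f ⊕ g) k = f k + g k

zeroS : ∀ {N} → PS N
zeroS k = 0ℚ

_⊛_ : ∀ {N} → PS N → PS N → PS N
(f ⊛ g) k = sumℚ (map (λ { (m , n) → f m * g n }) (splits k))

_^ˢ_ : ∀ {N} → PS N → ℕ → PS N
f ^ˢ zero    = oneS
f ^ˢ (suc j) = f ⊛ (f ^ˢ j)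

-- (1 + L)^a := Σ_{j ≥ 0} binom a j · L^j  for L with zero constant term.
-- The coefficient of x^k only receives contributions from j ≤ deg k
-- (L^j has no monomials of degree < j), so the formal sum is the
-- finite sum below.
onePlusPow : ∀ {N} → PS N → ℚ → PS N
onePlusPow L a k = sumℚ (map (λ j → binom a j * (L ^ˢ j) k) (upTo (suc (deg k))))

allFin : (N : ℕ) → List (Fin N)
allFin N = List.allFin N

partialSumVars : ∀ {N} → Fin N → PS N
partialSumVars {N} j =
  foldr _⊕_ zeroS (map var (filter (λ i → toℕ i ℕ.≤? toℕ j) (allFin N)))

prodS : ∀ {N} → List (PS N) → PS N
prodS = foldr _⊛_ oneS

theSeries : ∀ {N} → (Fin N → ℚ) → PS N
theSeries {N} b = prodS (map (λ j → onePlusPow (partialSumVars j) (b j)) (allFin N))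

sumFrom : ∀ {N} → (Fin N → ℚ) → Fin N → ℚ
sumFrom {N} b j = sumℚ (map b (filter (λ i → toℕ j ℕ.≤? toℕ i) (allFin N)))

sumAfter : ∀ {N} → (Fin N → ℕ) → Fin N → ℚ
sumAfter {N} k j = sumℚ (map (λ i → ℕ→ℚ (k i)) (filter (λ i → toℕ j ℕ.<? toℕ i) (allFin N)))

prodℚ : List ℚ → ℚ
prodℚ = foldr _*_ 1ℚ

closedForm : ∀ {N} → (Fin N → ℚ) → (Fin N → ℕ) → ℚ
closedForm {N} b k = prodℚ (map (λ j → binom (sumFrom b j - sumAfter k j) (k j)) (allFin N))

-- Induction on N, extracting the coefficient of x_N^{k_N}. Only the last factor
-- (1 + L + x_N)^{b_N}, L = x_1 + ... + x_{N-1}, involves x_N, and the trinomial revision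
-- binom(b, j) binom(j, t) = binom(b, t) binom(b - t, j - t) shows that its x_N^t-coefficient is
-- binom(b_N, t) (1 + L)^{b_N - t}. By the exponent law (1 + L)^a (1 + L)^c = (1 + L)^(a + c),
-- itself Vandermonde's identity one variable at a time, this merges into the factor
-- (1 + L)^{b_{N-1}}: what remains is the same product in N - 1 variables with b_{N-1}
-- replaced by b_{N-1} + b_N - k_N, and the closed form obeys the same recursion.
-- The upper indices being rational, identities between binomial coefficients are proved by
-- showing that both sides satisfy the recurrence binom(a, t+1) (t+1) = binom(a, t) (a - t).

module Submission where

open import Defs
open import Data.Bool using (Bool; true; false; if_then_else_)
open import Data.Fin using (Fin; zero; suc; toℕ; fromℕ; inject₁)
import Data.Fin.Properties as Fin
import Data.Integer as ℤ using (+_; _*_; _+_)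
import Data.Integer.Properties as ℤ
open import Data.List using (List; []; _∷_; map; foldr; upTo; concatMap; filter; _++_)
import Data.List as List
import Data.List.Properties as List
open import Data.Nat as ℕ using (ℕ; zero; suc; _!)
import Data.Nat.Coprimality as Coprime
import Data.Nat.Properties as ℕ
open import Data.Product using (_×_; _,_)
open import Data.Rational using (ℚ; 0ℚ; 1ℚ; _+_; _*_; _-_; _/_; mkℚ; 1/_; ≢-nonZero)
import Data.Rational.Properties as ℚ
open import Data.Sum using (_⊎_; inj₁; inj₂)
open import Data.Vec as Vec using (Vec; []; _∷_; _∷ʳ_; tabulate)
import Data.Vec.Properties as Vec
open import Function using (_∘_; const)
open import Level using (0ℓ)
open import Relation.Binary.PropositionalEquality
open import Relation.Nullary using (¬_; does; yes; no)
open import Relation.Nullary.Decidable using (dec-true; dec-false; dec⇒maybe)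
open import Relation.Unary using (Pred; Decidable)
open import Tactic.RingSolver using (solve-∀)
import Tactic.RingSolver.Core.AlmostCommutativeRing as ACR

ℚ-ring : ACR.AlmostCommutativeRing 0ℓ 0ℓ
ℚ-ring = ACR.fromCommutativeRing ℚ.+-*-commutativeRing (λ x → dec⇒maybe (0ℚ ℚ.≟ x))

open ≡-Reasoning

ℕ→ℚ≡mkℚ : ∀ n → ℕ→ℚ n ≡ mkℚ (ℤ.+ n) 0 (Coprime.sym (Coprime.1-coprimeTo n))
ℕ→ℚ≡mkℚ n = ℚ.normalize-coprime (Coprime.sym (Coprime.1-coprimeTo n))

ℕ→ℚ-homo-+ : ∀ m n → ℕ→ℚ (m ℕ.+ n) ≡ ℕ→ℚ m + ℕ→ℚ n
ℕ→ℚ-homo-+ m n rewrite ℕ→ℚ≡mkℚ m | ℕ→ℚ≡mkℚ n =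
  trans (ℕ→ℚ≡mkℚ (m ℕ.+ n)) (sym (trans
    (ℚ./-cong {p₁ = ℤ.+ m ℤ.* ℤ.+ 1 ℤ.+ ℤ.+ n ℤ.* ℤ.+ 1} {q₁ = 1}
      (cong₂ ℤ._+_ (ℤ.*-identityʳ (ℤ.+ m)) (ℤ.*-identityʳ (ℤ.+ n))) refl)
    (ℕ→ℚ≡mkℚ (m ℕ.+ n))))

ℕ→ℚ-homo-* : ∀ m n → ℕ→ℚ (m ℕ.* n) ≡ ℕ→ℚ m * ℕ→ℚ n
ℕ→ℚ-homo-* m n rewrite ℕ→ℚ≡mkℚ m | ℕ→ℚ≡mkℚ n =
  trans (ℕ→ℚ≡mkℚ (m ℕ.* n)) (sym (trans
    (ℚ./-cong {p₁ = ℤ.+ m ℤ.* ℤ.+ n} {q₁ = 1} (sym (ℤ.pos-* m n)) refl)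
    (ℕ→ℚ≡mkℚ (m ℕ.* n))))

ℕ→ℚ-suc : ∀ n → ℕ→ℚ (suc n) ≡ 1ℚ + ℕ→ℚ n
ℕ→ℚ-suc = ℕ→ℚ-homo-+ 1

ℕ→ℚ-nonZero : ∀ n .{{_ : ℕ.NonZero n}} → ℕ→ℚ n ≢ 0ℚ
ℕ→ℚ-nonZero (suc n) eq with trans (sym (ℕ→ℚ≡mkℚ (suc n))) eq
... | ()

1/n*n≡1 : ∀ n .{{_ : ℕ.NonZero n}} → (ℤ.+ 1 / n) * ℕ→ℚ n ≡ 1ℚ
1/n*n≡1 (suc n) rewrite ℕ→ℚ≡mkℚ (suc n) | ℚ.normalize-coprime {1} {n} (Coprime.1-coprimeTo (suc n)) =
  ℚ.*-inverseˡ (mkℚ (ℤ.+ suc n) 0 (Coprime.sym (Coprime.1-coprimeTo (suc n))))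

*-cancelʳ : ∀ {x y c} → c ≢ 0ℚ → x * c ≡ y * c → x ≡ y
*-cancelʳ {x} {y} {c} c≢0 eq = begin
  x                 ≡⟨ divide x ⟩
  (x * c) * 1/ c    ≡⟨ cong (_* 1/ c) eq ⟩
  (y * c) * 1/ c    ≡⟨ divide y ⟨
  y                 ∎
  where
  instance _ = ≢-nonZero c≢0
  divide : ∀ z → z ≡ (z * c) * 1/ c
  divide z = begin
    z                ≡⟨ ℚ.*-identityʳ z ⟨
    z * 1ℚ           ≡⟨ cong (z *_) (ℚ.*-inverseʳ c) ⟨
    z * (c * 1/ c)   ≡⟨ ℚ.*-assoc z c _ ⟨
    (z * c) * 1/ c   ∎

recurrence-unique : (f g c m : ℕ → ℚ) → (∀ t → m t ≢ 0ℚ) → f 0 ≡ g 0 →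
  (∀ t → f (suc t) * m t ≡ f t * c t) →
  (∀ t → g (suc t) * m t ≡ g t * c t) → ∀ t → f t ≡ g t
recurrence-unique f g c m m≢0 f0≡g0 rec-f rec-g zero = f0≡g0
recurrence-unique f g c m m≢0 f0≡g0 rec-f rec-g (suc t) = *-cancelʳ (m≢0 t) (begin
  f (suc t) * m t   ≡⟨ rec-f t ⟩
  f t * c t         ≡⟨ cong (_* c t) (recurrence-unique f g c m m≢0 f0≡g0 rec-f rec-g t) ⟩
  g t * c t         ≡⟨ rec-g t ⟨
  g (suc t) * m t   ∎)

-- Generalised binomial coefficients

binom*!≡falling : ∀ a t → binom a t * ℕ→ℚ (t !) ≡ falling a t
binom*!≡falling a t = begin
  (falling a t * r) * ℕ→ℚ (t !)  ≡⟨ ℚ.*-assoc (falling a t) r _ ⟩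
  falling a t * (r * ℕ→ℚ (t !))  ≡⟨ cong (falling a t *_) (1/n*n≡1 (t !) {{t ℕ.!≢0}}) ⟩
  falling a t * 1ℚ               ≡⟨ ℚ.*-identityʳ _ ⟩
  falling a t                    ∎
  where r = (ℤ.+ 1 / (t !)) {{t ℕ.!≢0}}

binom-suc : ∀ a t → binom a (suc t) * ℕ→ℚ (suc t) ≡ binom a t * (a - ℕ→ℚ t)
binom-suc a t = *-cancelʳ (ℕ→ℚ-nonZero (t !) {{t ℕ.!≢0}}) (begin
  binom a (suc t) * ℕ→ℚ (suc t) * ℕ→ℚ (t !)    ≡⟨ ℚ.*-assoc (binom a (suc t)) _ _ ⟩
  binom a (suc t) * (ℕ→ℚ (suc t) * ℕ→ℚ (t !))  ≡⟨ cong (binom a (suc t) *_) (ℕ→ℚ-homo-* (suc t) (t !)) ⟨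
  binom a (suc t) * ℕ→ℚ (suc t !)              ≡⟨ binom*!≡falling a (suc t) ⟩
  falling a t * (a - ℕ→ℚ t)                    ≡⟨ cong (_* (a - ℕ→ℚ t)) (binom*!≡falling a t) ⟨
  binom a t * ℕ→ℚ (t !) * (a - ℕ→ℚ t)          ≡⟨ swap (binom a t) (ℕ→ℚ (t !)) (a - ℕ→ℚ t) ⟩
  binom a t * (a - ℕ→ℚ t) * ℕ→ℚ (t !)          ∎)
  where
  swap : ∀ x y z → x * y * z ≡ x * z * y
  swap = solve-∀ ℚ-ring

binom-1 : ∀ a → binom a 1 ≡ a
binom-1 = unfolded
  where
  unfolded : ∀ a → 1ℚ * (a - 0ℚ) * 1ℚ ≡ a
  unfolded = solve-∀ ℚ-ring

falling≡0⇒binom≡0 : ∀ a t → falling a t ≡ 0ℚ → binom a t ≡ 0ℚ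
falling≡0⇒binom≡0 a t eq = trans (cong (_* r) eq) (ℚ.*-zeroˡ r)
  where r = (ℤ.+ 1 / (t !)) {{t ℕ.!≢0}}

binom-vanishes : ∀ {j t} → j ℕ.< t → binom (ℕ→ℚ j) t ≡ 0ℚ
binom-vanishes {j} {suc t} (ℕ.s≤s j≤t) with ℕ.m≤n⇒∃[o]m+o≡n j≤t
... | d , refl = falling≡0⇒binom≡0 (ℕ→ℚ j) (suc (j ℕ.+ d)) (falling-vanishes d)
  where
  falling-vanishes : ∀ d → falling (ℕ→ℚ j) (suc (j ℕ.+ d)) ≡ 0ℚ
  falling-vanishes zero rewrite ℕ.+-identityʳ j =
    trans (cong (falling (ℕ→ℚ j) j *_) (ℚ.+-inverseʳ (ℕ→ℚ j))) (ℚ.*-zeroʳ (falling (ℕ→ℚ j) j))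
  falling-vanishes (suc d) rewrite ℕ.+-suc j d =
    trans (cong (_* (ℕ→ℚ j - ℕ→ℚ (suc (j ℕ.+ d)))) (falling-vanishes d)) (ℚ.*-zeroˡ (ℕ→ℚ j - ℕ→ℚ (suc (j ℕ.+ d))))

binom-pascal : ∀ a t → binom (1ℚ + a) (suc t) ≡ binom a (suc t) + binom a t
binom-pascal a = recurrence-unique
  (λ t → binom (1ℚ + a) (suc t)) (λ t → binom a (suc t) + binom a t)
  (λ t → (1ℚ + a) - ℕ→ℚ (suc t)) (λ t → ℕ→ℚ (suc (suc t))) (λ t → ℕ→ℚ-nonZero (suc (suc t)))
  (begin
    binom (1ℚ + a) 1          ≡⟨ binom-1 (1ℚ + a) ⟩
    1ℚ + a                    ≡⟨ ℚ.+-comm 1ℚ a ⟩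
    a + 1ℚ                    ≡⟨ cong (_+ 1ℚ) (binom-1 a) ⟨
    binom a 1 + binom a 0     ∎)
  (λ t → binom-suc (1ℚ + a) (suc t))
  pascal-recurrence
  where
  regroup : ∀ c a n → c * (a - (1ℚ + n)) + c * (1ℚ + (1ℚ + n)) ≡ c * (a - n) + c * (1ℚ + n)
  regroup = solve-∀ ℚ-ring
  factor : ∀ c d a n → c * (a - n) + d * (a - n) ≡ (c + d) * ((1ℚ + a) - (1ℚ + n))
  factor = solve-∀ ℚ-ring
  pascal-recurrence : ∀ t → (binom a (suc (suc t)) + binom a (suc t)) * ℕ→ℚ (suc (suc t))
                          ≡ (binom a (suc t) + binom a t) * ((1ℚ + a) - ℕ→ℚ (suc t))
  pascal-recurrence t = begin
    (C₂ + C₁) * ℕ→ℚ (suc (suc t))                  ≡⟨ ℚ.*-distribʳ-+ _ C₂ C₁ ⟩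
    C₂ * ℕ→ℚ (suc (suc t)) + C₁ * ℕ→ℚ (suc (suc t)) ≡⟨ cong (_+ C₁ * ℕ→ℚ (suc (suc t))) (binom-suc a (suc t)) ⟩
    C₁ * (a - ℕ→ℚ (suc t)) + C₁ * ℕ→ℚ (suc (suc t))
      ≡⟨ cong₂ (λ u v → C₁ * (a - u) + C₁ * v) (ℕ→ℚ-suc t) (trans (ℕ→ℚ-suc (suc t)) (cong (λ u → 1ℚ + u) (ℕ→ℚ-suc t))) ⟩
    C₁ * (a - (1ℚ + n)) + C₁ * (1ℚ + (1ℚ + n))     ≡⟨ regroup C₁ a n ⟩
    C₁ * (a - n) + C₁ * (1ℚ + n)                   ≡⟨ cong (λ u → C₁ * (a - n) + C₁ * u) (ℕ→ℚ-suc t) ⟨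
    C₁ * (a - n) + C₁ * ℕ→ℚ (suc t)                ≡⟨ cong (λ u → C₁ * (a - n) + u) (binom-suc a t) ⟩
    C₁ * (a - n) + C₀ * (a - n)                    ≡⟨ factor C₁ C₀ a n ⟩
    (C₁ + C₀) * ((1ℚ + a) - (1ℚ + n))              ≡⟨ cong (λ u → (C₁ + C₀) * ((1ℚ + a) - u)) (ℕ→ℚ-suc t) ⟨
    (C₁ + C₀) * ((1ℚ + a) - ℕ→ℚ (suc t))           ∎
    where C₂ = binom a (suc (suc t)); C₁ = binom a (suc t); C₀ = binom a t; n = ℕ→ℚ t

binom-diagonal : ∀ t → binom (ℕ→ℚ t) t ≡ 1ℚ
binom-diagonal zero = refl
binom-diagonal (suc t) = begin
  binom (ℕ→ℚ (suc t)) (suc t)              ≡⟨ cong (λ x → binom x (suc t)) (ℕ→ℚ-suc t) ⟩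
  binom (1ℚ + ℕ→ℚ t) (suc t)               ≡⟨ binom-pascal (ℕ→ℚ t) t ⟩
  binom (ℕ→ℚ t) (suc t) + binom (ℕ→ℚ t) t  ≡⟨ cong₂ _+_ (binom-vanishes (ℕ.n<1+n t)) (binom-diagonal t) ⟩
  0ℚ + 1ℚ                                  ≡⟨⟩
  1ℚ                                       ∎

binom-absorption : ∀ a t → binom (1ℚ + a) t * ((1ℚ + a) - ℕ→ℚ t) ≡ (1ℚ + a) * binom a t
binom-absorption a t = begin
  binom (1ℚ + a) t * ((1ℚ + a) - ℕ→ℚ t)              ≡⟨ binom-suc (1ℚ + a) t ⟨
  binom (1ℚ + a) (suc t) * ℕ→ℚ (suc t)               ≡⟨ cong (_* ℕ→ℚ (suc t)) (binom-pascal a t) ⟩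
  (binom a (suc t) + binom a t) * ℕ→ℚ (suc t)        ≡⟨ ℚ.*-distribʳ-+ (ℕ→ℚ (suc t)) (binom a (suc t)) (binom a t) ⟩
  binom a (suc t) * ℕ→ℚ (suc t) + binom a t * ℕ→ℚ (suc t)
    ≡⟨ cong₂ _+_ (binom-suc a t) (cong (binom a t *_) (ℕ→ℚ-suc t)) ⟩
  binom a t * (a - ℕ→ℚ t) + binom a t * (1ℚ + ℕ→ℚ t) ≡⟨ collect (binom a t) a (ℕ→ℚ t) ⟩
  (1ℚ + a) * binom a t                               ∎
  where
  collect : ∀ c a n → c * (a - n) + c * (1ℚ + n) ≡ (1ℚ + a) * c
  collect = solve-∀ ℚ-ring

binom-trinomial : ∀ b t i →
  binom b (t ℕ.+ i) * binom (ℕ→ℚ (t ℕ.+ i)) t ≡ binom b t * binom (b - ℕ→ℚ t) i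
binom-trinomial b t = recurrence-unique
  (λ i → binom b (t ℕ.+ i) * binom (ℕ→ℚ (t ℕ.+ i)) t) (λ i → binom b t * binom (b - ℕ→ℚ t) i)
  (λ i → (b - ℕ→ℚ t) - ℕ→ℚ i) (λ i → ℕ→ℚ (suc i)) (λ i → ℕ→ℚ-nonZero (suc i))
  initial trinomial-recurrence
  (λ i → trans (ℚ.*-assoc (binom b t) _ _)
    (trans (cong (binom b t *_) (binom-suc (b - ℕ→ℚ t) i)) (sym (ℚ.*-assoc (binom b t) _ _))))
  where
  initial : binom b (t ℕ.+ 0) * binom (ℕ→ℚ (t ℕ.+ 0)) t ≡ binom b t * 1ℚ
  initial rewrite ℕ.+-identityʳ t = cong (binom b t *_) (binom-diagonal t)

  shift : ∀ i → let m = t ℕ.+ i in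
    binom (ℕ→ℚ (suc m)) t * ℕ→ℚ (suc i) ≡ ℕ→ℚ (suc m) * binom (ℕ→ℚ m) t
  shift i = begin
    binom (ℕ→ℚ (suc m)) t * ℕ→ℚ (suc i)
      ≡⟨ cong₂ (λ u v → binom u t * v) (ℕ→ℚ-suc m) (trans (ℕ→ℚ-suc i) suc-i) ⟩
    binom (1ℚ + ℕ→ℚ m) t * ((1ℚ + ℕ→ℚ m) - ℕ→ℚ t)  ≡⟨ binom-absorption (ℕ→ℚ m) t ⟩
    (1ℚ + ℕ→ℚ m) * binom (ℕ→ℚ m) t                ≡⟨ cong (_* binom (ℕ→ℚ m) t) (ℕ→ℚ-suc m) ⟨
    ℕ→ℚ (suc m) * binom (ℕ→ℚ m) t                 ∎
    where
    m = t ℕ.+ i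
    cancel : ∀ x y → 1ℚ + y ≡ (1ℚ + (x + y)) - x
    cancel = solve-∀ ℚ-ring
    suc-i : 1ℚ + ℕ→ℚ i ≡ (1ℚ + ℕ→ℚ m) - ℕ→ℚ t
    suc-i = trans (cancel (ℕ→ℚ t) (ℕ→ℚ i)) (cong (λ u → (1ℚ + u) - ℕ→ℚ t) (sym (ℕ→ℚ-homo-+ t i)))

  regroup : ∀ c b x y d → c * (b - (x + y)) * d ≡ c * d * ((b - x) - y)
  regroup = solve-∀ ℚ-ring

  trinomial-recurrence : ∀ i →
    binom b (t ℕ.+ suc i) * binom (ℕ→ℚ (t ℕ.+ suc i)) t * ℕ→ℚ (suc i)
      ≡ binom b (t ℕ.+ i) * binom (ℕ→ℚ (t ℕ.+ i)) t * ((b - ℕ→ℚ t) - ℕ→ℚ i)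
  trinomial-recurrence i rewrite ℕ.+-suc t i = begin
    binom b (suc m) * binom (ℕ→ℚ (suc m)) t * ℕ→ℚ (suc i)    ≡⟨ ℚ.*-assoc (binom b (suc m)) _ _ ⟩
    binom b (suc m) * (binom (ℕ→ℚ (suc m)) t * ℕ→ℚ (suc i))  ≡⟨ cong (binom b (suc m) *_) (shift i) ⟩
    binom b (suc m) * (ℕ→ℚ (suc m) * binom (ℕ→ℚ m) t)        ≡⟨ ℚ.*-assoc (binom b (suc m)) _ _ ⟨
    binom b (suc m) * ℕ→ℚ (suc m) * binom (ℕ→ℚ m) t          ≡⟨ cong (_* binom (ℕ→ℚ m) t) (binom-suc b m) ⟩
    binom b m * (b - ℕ→ℚ m) * binom (ℕ→ℚ m) t
      ≡⟨ cong (λ u → binom b m * (b - u) * binom (ℕ→ℚ m) t) (ℕ→ℚ-homo-+ t i) ⟩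
    binom b m * (b - (ℕ→ℚ t + ℕ→ℚ i)) * binom (ℕ→ℚ m) t      ≡⟨ regroup (binom b m) b (ℕ→ℚ t) (ℕ→ℚ i) _ ⟩
    binom b m * binom (ℕ→ℚ m) t * ((b - ℕ→ℚ t) - ℕ→ℚ i)      ∎
    where m = t ℕ.+ i

-- Sums over i + j = k and Vandermonde's identity

antidiagonalSum : (ℕ → ℕ → ℚ) → ℕ → ℚ
antidiagonalSum h zero    = h 0 0
antidiagonalSum h (suc k) = h 0 (suc k) + antidiagonalSum (λ i j → h (suc i) j) k

antidiagonalSum-cong : ∀ {h h′ : ℕ → ℕ → ℚ} k → (∀ i j → i ℕ.+ j ≡ k → h i j ≡ h′ i j) →
  antidiagonalSum h k ≡ antidiagonalSum h′ k
antidiagonalSum-cong zero    eq = eq 0 0 refl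
antidiagonalSum-cong (suc k) eq =
  cong₂ _+_ (eq 0 (suc k) refl) (antidiagonalSum-cong k (λ i j i+j≡k → eq (suc i) j (cong suc i+j≡k)))

antidiagonalSum-+ : ∀ h h′ k →
  antidiagonalSum (λ i j → h i j + h′ i j) k ≡ antidiagonalSum h k + antidiagonalSum h′ k
antidiagonalSum-+ h h′ zero    = refl
antidiagonalSum-+ h h′ (suc k) =
  trans (cong (λ u → h 0 (suc k) + h′ 0 (suc k) + u) (antidiagonalSum-+ _ _ k))
        (interchange (h 0 (suc k)) (h′ 0 (suc k)) _ _)
  where
  interchange : ∀ a b c d → a + b + (c + d) ≡ a + c + (b + d)
  interchange = solve-∀ ℚ-ring

antidiagonalSum-− : ∀ h h′ k →
  antidiagonalSum (λ i j → h i j - h′ i j) k ≡ antidiagonalSum h k - antidiagonalSum h′ k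
antidiagonalSum-− h h′ zero    = refl
antidiagonalSum-− h h′ (suc k) =
  trans (cong (λ u → h 0 (suc k) - h′ 0 (suc k) + u) (antidiagonalSum-− _ _ k))
        (interchange (h 0 (suc k)) (h′ 0 (suc k)) _ _)
  where
  interchange : ∀ a b c d → a - b + (c - d) ≡ a + c - (b + d)
  interchange = solve-∀ ℚ-ring

antidiagonalSum-* : ∀ c h k → antidiagonalSum (λ i j → c * h i j) k ≡ c * antidiagonalSum h k
antidiagonalSum-* c h zero    = refl
antidiagonalSum-* c h (suc k) =
  trans (cong (λ u → c * h 0 (suc k) + u) (antidiagonalSum-* c _ k)) (sym (ℚ.*-distribˡ-+ c _ _))

antidiagonalSum-zero : ∀ h → (∀ i j → h i j ≡ 0ℚ) → ∀ k → antidiagonalSum h k ≡ 0ℚ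
antidiagonalSum-zero h h≡0 zero    = h≡0 0 0
antidiagonalSum-zero h h≡0 (suc k) =
  cong₂ _+_ (h≡0 0 (suc k)) (antidiagonalSum-zero _ (λ i j → h≡0 (suc i) j) k)

antidiagonalSum-first : ∀ h → (∀ i j → h (suc i) j ≡ 0ℚ) → ∀ k → antidiagonalSum h k ≡ h 0 k
antidiagonalSum-first h h≡0 zero    = refl
antidiagonalSum-first h h≡0 (suc k) =
  trans (cong (λ u → h 0 (suc k) + u) (antidiagonalSum-zero _ h≡0 k)) (ℚ.+-identityʳ _)

antidiagonalSum-last : ∀ h → (∀ i j → h i (suc j) ≡ 0ℚ) → ∀ k → antidiagonalSum h k ≡ h k 0
antidiagonalSum-last h h≡0 zero    = refl
antidiagonalSum-last h h≡0 (suc k) =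
  trans (cong₂ _+_ (h≡0 0 k) (antidiagonalSum-last _ (λ i j → h≡0 (suc i) j) k)) (ℚ.+-identityˡ _)

antidiagonalSum-shiftˡ : ∀ h → (∀ j → h 0 j ≡ 0ℚ) → ∀ k →
  antidiagonalSum h (suc k) ≡ antidiagonalSum (λ i j → h (suc i) j) k
antidiagonalSum-shiftˡ h h≡0 k =
  trans (cong (_+ antidiagonalSum (λ i j → h (suc i) j) k) (h≡0 (suc k))) (ℚ.+-identityˡ _)

antidiagonalSum-snoc : ∀ h k →
  antidiagonalSum h (suc k) ≡ antidiagonalSum (λ i j → h i (suc j)) k + h (suc k) 0
antidiagonalSum-snoc h zero    = refl
antidiagonalSum-snoc h (suc k) =
  trans (cong (λ u → h 0 (suc (suc k)) + u) (antidiagonalSum-snoc (λ i j → h (suc i) j) k))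
        (sym (ℚ.+-assoc (h 0 (suc (suc k))) _ _))

antidiagonalSum-shiftʳ : ∀ h → (∀ i → h i 0 ≡ 0ℚ) → ∀ k →
  antidiagonalSum h (suc k) ≡ antidiagonalSum (λ i j → h i (suc j)) k
antidiagonalSum-shiftʳ h h≡0 k =
  trans (antidiagonalSum-snoc h k)
        (trans (cong (antidiagonalSum (λ i j → h i (suc j)) k +_) (h≡0 (suc k))) (ℚ.+-identityʳ _))

antidiagonalSum-swap : ∀ (H : ℕ → ℕ → ℕ → ℕ → ℚ) k t →
  antidiagonalSum (λ i j → antidiagonalSum (H i j) t) k
    ≡ antidiagonalSum (λ i′ j′ → antidiagonalSum (λ i j → H i j i′ j′) k) t
antidiagonalSum-swap H zero    t = refl
antidiagonalSum-swap H (suc k) t =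
  trans (cong (λ u → antidiagonalSum (H 0 (suc k)) t + u) (antidiagonalSum-swap (λ i → H (suc i)) k t))
        (sym (antidiagonalSum-+ _ _ t))

antidiagonalSum-weight : ∀ h k →
  antidiagonalSum (λ i j → ℕ→ℚ i * h i j) k + antidiagonalSum (λ i j → ℕ→ℚ j * h i j) k
    ≡ ℕ→ℚ k * antidiagonalSum h k
antidiagonalSum-weight h k = begin
  antidiagonalSum (λ i j → ℕ→ℚ i * h i j) k + antidiagonalSum (λ i j → ℕ→ℚ j * h i j) k
    ≡⟨ antidiagonalSum-+ _ _ k ⟨
  antidiagonalSum (λ i j → ℕ→ℚ i * h i j + ℕ→ℚ j * h i j) k
    ≡⟨ antidiagonalSum-cong k (λ i j i+j≡k → begin
         ℕ→ℚ i * h i j + ℕ→ℚ j * h i j  ≡⟨ ℚ.*-distribʳ-+ (h i j) (ℕ→ℚ i) (ℕ→ℚ j) ⟨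
         (ℕ→ℚ i + ℕ→ℚ j) * h i j        ≡⟨ cong (_* h i j) (ℕ→ℚ-homo-+ i j) ⟨
         ℕ→ℚ (i ℕ.+ j) * h i j          ≡⟨ cong (λ n → ℕ→ℚ n * h i j) i+j≡k ⟩
         ℕ→ℚ k * h i j                  ∎) ⟩
  antidiagonalSum (λ i j → ℕ→ℚ k * h i j) k
    ≡⟨ antidiagonalSum-* (ℕ→ℚ k) h k ⟩
  ℕ→ℚ k * antidiagonalSum h k ∎

vandermonde : ∀ a c k → antidiagonalSum (λ i j → binom a i * binom c j) k ≡ binom (a + c) k
vandermonde a c = recurrence-unique (antidiagonalSum h) (binom (a + c))
  (λ k → (a + c) - ℕ→ℚ k) (λ k → ℕ→ℚ (suc k)) (λ k → ℕ→ℚ-nonZero (suc k))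
  refl vandermonde-recurrence (binom-suc (a + c))
  where
  h : ℕ → ℕ → ℚ
  h i j = binom a i * binom c j

  rearrangeˡ : ∀ n A C → n * (A * C) ≡ (A * n) * C
  rearrangeˡ = solve-∀ ℚ-ring
  rearrangeʳ : ∀ n A C → n * (A * C) ≡ A * (C * n)
  rearrangeʳ = solve-∀ ℚ-ring
  distribute : ∀ a c x y H → (a - x) * H + (c - y) * H ≡ (a + c) * H - (x * H + y * H)
  distribute = solve-∀ ℚ-ring
  factor : ∀ s n V → s * V - n * V ≡ V * (s - n)
  factor = solve-∀ ℚ-ring

  lower-i : ∀ i j → ℕ→ℚ (suc i) * h (suc i) j ≡ (a - ℕ→ℚ i) * h i j
  lower-i i j = begin
    ℕ→ℚ (suc i) * h (suc i) j                  ≡⟨ rearrangeˡ (ℕ→ℚ (suc i)) (binom a (suc i)) (binom c j) ⟩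
    binom a (suc i) * ℕ→ℚ (suc i) * binom c j  ≡⟨ cong (_* binom c j) (binom-suc a i) ⟩
    binom a i * (a - ℕ→ℚ i) * binom c j        ≡⟨ rearrangeˡ (a - ℕ→ℚ i) (binom a i) (binom c j) ⟨
    (a - ℕ→ℚ i) * h i j                        ∎

  lower-j : ∀ i j → ℕ→ℚ (suc j) * h i (suc j) ≡ (c - ℕ→ℚ j) * h i j
  lower-j i j = begin
    ℕ→ℚ (suc j) * h i (suc j)                  ≡⟨ rearrangeʳ (ℕ→ℚ (suc j)) (binom a i) (binom c (suc j)) ⟩
    binom a i * (binom c (suc j) * ℕ→ℚ (suc j)) ≡⟨ cong (binom a i *_) (binom-suc c j) ⟩
    binom a i * (binom c j * (c - ℕ→ℚ j))      ≡⟨ rearrangeʳ (c - ℕ→ℚ j) (binom a i) (binom c j) ⟨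
    (c - ℕ→ℚ j) * h i j                        ∎

  vandermonde-recurrence : ∀ k →
    antidiagonalSum h (suc k) * ℕ→ℚ (suc k) ≡ antidiagonalSum h k * ((a + c) - ℕ→ℚ k)
  vandermonde-recurrence k = begin
    antidiagonalSum h (suc k) * ℕ→ℚ (suc k)
      ≡⟨ ℚ.*-comm _ (ℕ→ℚ (suc k)) ⟩
    ℕ→ℚ (suc k) * antidiagonalSum h (suc k)
      ≡⟨ antidiagonalSum-weight h (suc k) ⟨
    antidiagonalSum (λ i j → ℕ→ℚ i * h i j) (suc k) + antidiagonalSum (λ i j → ℕ→ℚ j * h i j) (suc k)
      ≡⟨ cong₂ _+_ (antidiagonalSum-shiftˡ (λ i j → ℕ→ℚ i * h i j) (λ j → ℚ.*-zeroˡ (h 0 j)) k)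
                   (antidiagonalSum-shiftʳ (λ i j → ℕ→ℚ j * h i j) (λ i → ℚ.*-zeroˡ (h i 0)) k) ⟩
    antidiagonalSum (λ i j → ℕ→ℚ (suc i) * h (suc i) j) k
      + antidiagonalSum (λ i j → ℕ→ℚ (suc j) * h i (suc j)) k
      ≡⟨ cong₂ _+_ (antidiagonalSum-cong k (λ i j _ → lower-i i j))
                   (antidiagonalSum-cong k (λ i j _ → lower-j i j)) ⟩
    antidiagonalSum (λ i j → (a - ℕ→ℚ i) * h i j) k + antidiagonalSum (λ i j → (c - ℕ→ℚ j) * h i j) k
      ≡⟨ antidiagonalSum-+ _ _ k ⟨
    antidiagonalSum (λ i j → (a - ℕ→ℚ i) * h i j + (c - ℕ→ℚ j) * h i j) k
      ≡⟨ antidiagonalSum-cong k (λ i j _ → distribute a c (ℕ→ℚ i) (ℕ→ℚ j) (h i j)) ⟩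
    antidiagonalSum (λ i j → (a + c) * h i j - (ℕ→ℚ i * h i j + ℕ→ℚ j * h i j)) k
      ≡⟨ antidiagonalSum-− _ _ k ⟩
    antidiagonalSum (λ i j → (a + c) * h i j) k
      - antidiagonalSum (λ i j → ℕ→ℚ i * h i j + ℕ→ℚ j * h i j) k
      ≡⟨ cong₂ _-_ (antidiagonalSum-* (a + c) h k)
                   (trans (antidiagonalSum-+ _ _ k) (antidiagonalSum-weight h k)) ⟩
    (a + c) * antidiagonalSum h k - ℕ→ℚ k * antidiagonalSum h k
      ≡⟨ factor (a + c) (ℕ→ℚ k) (antidiagonalSum h k) ⟩
    antidiagonalSum h k * ((a + c) - ℕ→ℚ k) ∎

-- Coefficients of products of power series

sumℚ-map-cong : ∀ {A : Set} {F G : A → ℚ} → F ≗ G → ∀ xs → sumℚ (map F xs) ≡ sumℚ (map G xs)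
sumℚ-map-cong F≗G xs = cong sumℚ (List.map-cong F≗G xs)

sumℚ-map-zero : ∀ {A : Set} {F : A → ℚ} → (∀ x → F x ≡ 0ℚ) → ∀ xs → sumℚ (map F xs) ≡ 0ℚ
sumℚ-map-zero F≡0 []       = refl
sumℚ-map-zero F≡0 (x ∷ xs) = cong₂ _+_ (F≡0 x) (sumℚ-map-zero F≡0 xs)

sumℚ-map-* : ∀ {A : Set} c (F : A → ℚ) xs → sumℚ (map (λ x → c * F x) xs) ≡ c * sumℚ (map F xs)
sumℚ-map-* c F []       = sym (ℚ.*-zeroʳ c)
sumℚ-map-* c F (x ∷ xs) =
  trans (cong (λ u → c * F x + u) (sumℚ-map-* c F xs)) (sym (ℚ.*-distribˡ-+ c (F x) _))

sumℚ-++ : ∀ xs ys → sumℚ (xs ++ ys) ≡ sumℚ xs + sumℚ ys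
sumℚ-++ []       ys = sym (ℚ.+-identityˡ _)
sumℚ-++ (x ∷ xs) ys = trans (cong (λ u → x + u) (sumℚ-++ xs ys)) (sym (ℚ.+-assoc x _ _))

sumℚ-map-concatMap : ∀ {A B : Set} (F : B → ℚ) (g : A → List B) xs →
  sumℚ (map F (concatMap g xs)) ≡ sumℚ (map (λ x → sumℚ (map F (g x))) xs)
sumℚ-map-concatMap F g []       = refl
sumℚ-map-concatMap F g (x ∷ xs) = begin
  sumℚ (map F (g x ++ concatMap g xs))                   ≡⟨ cong sumℚ (List.map-++ F (g x) _) ⟩
  sumℚ (map F (g x) ++ map F (concatMap g xs))           ≡⟨ sumℚ-++ (map F (g x)) _ ⟩
  sumℚ (map F (g x)) + sumℚ (map F (concatMap g xs))     ≡⟨ cong (λ u → sumℚ (map F (g x)) + u) (sumℚ-map-concatMap F g xs) ⟩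
  sumℚ (map F (g x)) + sumℚ (map (λ y → sumℚ (map F (g y))) xs) ∎

sumℚ-upTo-suc : ∀ (f : ℕ → ℚ) n → sumℚ (map f (upTo (suc n))) ≡ f 0 + sumℚ (map (f ∘ suc) (upTo n))
sumℚ-upTo-suc f n = trans (cong sumℚ (List.map-upTo f (suc n)))
  (cong (λ u → f 0 + u) (sym (cong sumℚ (List.map-upTo (f ∘ suc) n))))

sumℚ-upTo-+ : ∀ (f : ℕ → ℚ) t n →
  sumℚ (map f (upTo (t ℕ.+ n))) ≡ sumℚ (map f (upTo t)) + sumℚ (map (λ i → f (t ℕ.+ i)) (upTo n))
sumℚ-upTo-+ f zero    n = sym (ℚ.+-identityˡ _)
sumℚ-upTo-+ f (suc t) n = begin
  sumℚ (map f (upTo (suc t ℕ.+ n)))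
    ≡⟨ sumℚ-upTo-suc f (t ℕ.+ n) ⟩
  f 0 + sumℚ (map (f ∘ suc) (upTo (t ℕ.+ n)))
    ≡⟨ cong (λ u → f 0 + u) (sumℚ-upTo-+ (f ∘ suc) t n) ⟩
  f 0 + (sumℚ (map (f ∘ suc) (upTo t)) + rest)
    ≡⟨ ℚ.+-assoc (f 0) _ rest ⟨
  f 0 + sumℚ (map (f ∘ suc) (upTo t)) + rest
    ≡⟨ cong (_+ rest) (sumℚ-upTo-suc f t) ⟨
  sumℚ (map f (upTo (suc t))) + rest ∎
  where rest = sumℚ (map (λ i → f (suc t ℕ.+ i)) (upTo n))

sumℚ-upTo-zero : ∀ (f : ℕ → ℚ) n → (∀ i → i ℕ.< n → f i ≡ 0ℚ) → sumℚ (map f (upTo n)) ≡ 0ℚ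
sumℚ-upTo-zero f zero    f≡0 = refl
sumℚ-upTo-zero f (suc n) f≡0 = trans (sumℚ-upTo-suc f n)
  (cong₂ _+_ (f≡0 0 (ℕ.s≤s ℕ.z≤n)) (sumℚ-upTo-zero (f ∘ suc) n (λ i i<n → f≡0 (suc i) (ℕ.s≤s i<n))))

sumℚ-upTo≡antidiagonalSum : ∀ h k →
  sumℚ (map (λ i → h i (k ℕ.∸ i)) (upTo (suc k))) ≡ antidiagonalSum h k
sumℚ-upTo≡antidiagonalSum h zero    = ℚ.+-identityʳ (h 0 0)
sumℚ-upTo≡antidiagonalSum h (suc k) = trans (sumℚ-upTo-suc (λ i → h i (suc k ℕ.∸ i)) (suc k))
  (cong (λ u → h 0 (suc k) + u) (sumℚ-upTo≡antidiagonalSum (λ i j → h (suc i) j) k))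

headCoeff : ∀ {N} → PS (suc N) → ℕ → PS N
headCoeff f i ks = f (i ∷ ks)

lastCoeff : ∀ {N} → PS (suc N) → ℕ → PS N
lastCoeff f t ms = f (ms ∷ʳ t)

infixl 7 _·_
_·_ : ∀ {N} → ℚ → PS N → PS N
(c · f) k = c * f k

⊛-headCoeff : ∀ {N} (f g : PS (suc N)) k ks →
  (f ⊛ g) (k ∷ ks) ≡ antidiagonalSum (λ i j → (headCoeff f i ⊛ headCoeff g j) ks) k
⊛-headCoeff {N} f g k ks = begin
  sumℚ (map term (concatMap prefixed (upTo (suc k))))
    ≡⟨ sumℚ-map-concatMap term prefixed (upTo (suc k)) ⟩
  sumℚ (map (λ i → sumℚ (map term (map (prefix i) (splits ks)))) (upTo (suc k)))
    ≡⟨ sumℚ-map-cong (λ i → cong sumℚ (sym (List.map-∘ (splits ks)))) (upTo (suc k)) ⟩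
  sumℚ (map (λ i → (headCoeff f i ⊛ headCoeff g (k ℕ.∸ i)) ks) (upTo (suc k)))
    ≡⟨ sumℚ-upTo≡antidiagonalSum (λ i j → (headCoeff f i ⊛ headCoeff g j) ks) k ⟩
  antidiagonalSum (λ i j → (headCoeff f i ⊛ headCoeff g j) ks) k ∎
  where
  term : Mono (suc N) × Mono (suc N) → ℚ
  term (m , n) = f m * g n
  prefix : ℕ → Mono N × Mono N → Mono (suc N) × Mono (suc N)
  prefix i (m , n) = (i ∷ m) , ((k ℕ.∸ i) ∷ n)
  prefixed : ℕ → List (Mono (suc N) × Mono (suc N))
  prefixed i = map (prefix i) (splits ks)

⊛-lastCoeff : ∀ {N} (f g : PS (suc N)) ms t →
  (f ⊛ g) (ms ∷ʳ t) ≡ antidiagonalSum (λ i j → (lastCoeff f i ⊛ lastCoeff g j) ms) t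
⊛-lastCoeff f g []       t = ⊛-headCoeff f g t []
⊛-lastCoeff f g (k ∷ ms) t = begin
  (f ⊛ g) (k ∷ (ms ∷ʳ t))
    ≡⟨ ⊛-headCoeff f g k (ms ∷ʳ t) ⟩
  antidiagonalSum (λ i j → (headCoeff f i ⊛ headCoeff g j) (ms ∷ʳ t)) k
    ≡⟨ antidiagonalSum-cong k (λ i j _ → ⊛-lastCoeff (headCoeff f i) (headCoeff g j) ms t) ⟩
  antidiagonalSum (λ i j → antidiagonalSum (λ i′ j′ →
      (lastCoeff (headCoeff f i) i′ ⊛ lastCoeff (headCoeff g j) j′) ms) t) k
    ≡⟨ antidiagonalSum-swap (λ i j i′ j′ → (lastCoeff (headCoeff f i) i′ ⊛ lastCoeff (headCoeff g j) j′) ms) k t ⟩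
  antidiagonalSum (λ i′ j′ → antidiagonalSum (λ i j →
      (headCoeff (lastCoeff f i′) i ⊛ headCoeff (lastCoeff g j′) j) ms) k) t
    ≡⟨ antidiagonalSum-cong t (λ i′ j′ _ → sym (⊛-headCoeff (lastCoeff f i′) (lastCoeff g j′) k ms)) ⟩
  antidiagonalSum (λ i j → (lastCoeff f i ⊛ lastCoeff g j) (k ∷ ms)) t ∎

⊛-cong : ∀ {N} {f f′ g g′ : PS N} → f ≗ f′ → g ≗ g′ → (f ⊛ g) ≗ (f′ ⊛ g′)
⊛-cong f≗f′ g≗g′ k = sumℚ-map-cong (λ { (m , n) → cong₂ _*_ (f≗f′ m) (g≗g′ n) }) (splits k)

⊛-·ˡ : ∀ {N} c (f g : PS N) → ((c · f) ⊛ g) ≗ c · (f ⊛ g)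
⊛-·ˡ c f g k = trans (sumℚ-map-cong (λ { (m , n) → ℚ.*-assoc c (f m) (g n) }) (splits k))
                     (sumℚ-map-* c _ (splits k))

⊛-·ʳ : ∀ {N} c (f g : PS N) → (f ⊛ (c · g)) ≗ c · (f ⊛ g)
⊛-·ʳ c f g k = trans (sumℚ-map-cong (λ { (m , n) → exchange (f m) c (g n) }) (splits k))
                     (sumℚ-map-* c _ (splits k))
  where
  exchange : ∀ x y z → x * (y * z) ≡ y * (x * z)
  exchange = solve-∀ ℚ-ring

⊛-zeroˡ : ∀ {N} {f : PS N} g → f ≗ zeroS → (f ⊛ g) ≗ zeroS
⊛-zeroˡ {f = f} g f≗0 k =
  sumℚ-map-zero (λ { (m , n) → trans (cong (_* g n) (f≗0 m)) (ℚ.*-zeroˡ (g n)) }) (splits k)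

⊛-zeroʳ : ∀ {N} f {g : PS N} → g ≗ zeroS → (f ⊛ g) ≗ zeroS
⊛-zeroʳ f {g} g≗0 k =
  sumℚ-map-zero (λ { (m , n) → trans (cong (f m *_) (g≗0 n)) (ℚ.*-zeroʳ (f m)) }) (splits k)

⊛-identityˡ : ∀ {N} (f : PS N) → (oneS ⊛ f) ≗ f
⊛-identityˡ {zero}  f []       = trans (ℚ.+-identityʳ _) (ℚ.*-identityˡ (f []))
⊛-identityˡ {suc N} f (k ∷ ks) = trans (⊛-headCoeff oneS f k ks)
  (trans (antidiagonalSum-first _ (λ i j → ⊛-zeroˡ (headCoeff f j) (λ _ → refl) ks) k)
         (⊛-identityˡ (headCoeff f k) ks))

⊛-identityʳ : ∀ {N} (f : PS N) → (f ⊛ oneS) ≗ f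
⊛-identityʳ {zero}  f []       = trans (ℚ.+-identityʳ _) (ℚ.*-identityʳ (f []))
⊛-identityʳ {suc N} f (k ∷ ks) = trans (⊛-headCoeff f oneS k ks)
  (trans (antidiagonalSum-last _ (λ i j → ⊛-zeroʳ (headCoeff f i) (λ _ → refl) ks) k)
         (⊛-identityʳ (headCoeff f k) ks))

-- Adjoining a variable

record IsLift {N} (L : PS (suc N)) (L′ : PS N) : Set where
  field
    lastCoeff-0   : lastCoeff L 0 ≗ L′
    lastCoeff-suc : ∀ t → lastCoeff L (suc t) ≗ zeroS

-- L = L′ + x_N, where L′ does not involve the new variable x_N.
record IsLiftPlusNewVar {N} (L : PS (suc N)) (L′ : PS N) : Set where
  field
    lastCoeff-0   : lastCoeff L 0 ≗ L′
    lastCoeff-1   : lastCoeff L 1 ≗ oneS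
    lastCoeff-2+  : ∀ t → lastCoeff L (suc (suc t)) ≗ zeroS

deg-∷ʳ : ∀ {N} (ms : Mono N) t → deg (ms ∷ʳ t) ≡ deg ms ℕ.+ t
deg-∷ʳ []       t = ℕ.+-identityʳ t
deg-∷ʳ (k ∷ ms) t = trans (cong (k ℕ.+_) (deg-∷ʳ ms t)) (sym (ℕ.+-assoc k (deg ms) t))

oneS-lift : ∀ {N} → IsLift (oneS {suc N}) oneS
oneS-lift = record { lastCoeff-0 = at-0 ; lastCoeff-suc = at-suc }
  where
  at-0 : ∀ {N} (ms : Mono N) → oneS (ms ∷ʳ 0) ≡ oneS ms
  at-0 []           = refl
  at-0 (zero ∷ ms)  = at-0 ms
  at-0 (suc k ∷ ms) = refl
  at-suc : ∀ {N} t (ms : Mono N) → oneS (ms ∷ʳ suc t) ≡ 0ℚ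
  at-suc t []           = refl
  at-suc t (zero ∷ ms)  = at-suc t ms
  at-suc t (suc k ∷ ms) = refl

lastCoeff-⊛-lift : ∀ {N} (f g : PS (suc N)) → (∀ t → lastCoeff f (suc t) ≗ zeroS) →
  ∀ t → lastCoeff (f ⊛ g) t ≗ (lastCoeff f 0 ⊛ lastCoeff g t)
lastCoeff-⊛-lift f g f-lift t ms = trans (⊛-lastCoeff f g ms t)
  (antidiagonalSum-first _ (λ i j → ⊛-zeroˡ (lastCoeff g j) (f-lift i) ms) t)

^ˢ-lift : ∀ {N} {L : PS (suc N)} {L′ : PS N} → IsLift L L′ → ∀ j → IsLift (L ^ˢ j) (L′ ^ˢ j)
^ˢ-lift lift zero    = oneS-lift
^ˢ-lift {L = L} lift (suc j) = record
  { lastCoeff-0   = λ ms → trans (lastCoeff-⊛-lift L (L ^ˢ j) L.lastCoeff-suc 0 ms)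
                                 (⊛-cong L.lastCoeff-0 IH.lastCoeff-0 ms)
  ; lastCoeff-suc = λ t ms → trans (lastCoeff-⊛-lift L (L ^ˢ j) L.lastCoeff-suc (suc t) ms)
                                   (⊛-zeroʳ (lastCoeff L 0) (IH.lastCoeff-suc t) ms)
  }
  where
  module L = IsLift lift
  module IH = IsLift (^ˢ-lift lift j)

onePlusPow-lift : ∀ {N} {L : PS (suc N)} {L′ : PS N} → IsLift L L′ → ∀ a →
  IsLift (onePlusPow L a) (onePlusPow L′ a)
onePlusPow-lift {L = L} {L′} lift a = record
  { lastCoeff-0 = λ ms → begin
      sumℚ (map (λ j → binom a j * (L ^ˢ j) (ms ∷ʳ 0)) (upTo (suc (deg (ms ∷ʳ 0)))))
        ≡⟨ cong (λ n → sumℚ (map (λ j → binom a j * (L ^ˢ j) (ms ∷ʳ 0)) (upTo (suc n))))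
                (trans (deg-∷ʳ ms 0) (ℕ.+-identityʳ (deg ms))) ⟩
      sumℚ (map (λ j → binom a j * (L ^ˢ j) (ms ∷ʳ 0)) (upTo (suc (deg ms))))
        ≡⟨ sumℚ-map-cong (λ j → cong (binom a j *_) (IsLift.lastCoeff-0 (^ˢ-lift lift j) ms)) (upTo (suc (deg ms))) ⟩
      onePlusPow L′ a ms ∎
  ; lastCoeff-suc = λ t ms → sumℚ-map-zero {F = λ j → binom a j * (L ^ˢ j) (ms ∷ʳ suc t)}
      (λ j → trans (cong (binom a j *_) (IsLift.lastCoeff-suc (^ˢ-lift lift j) t ms)) (ℚ.*-zeroʳ (binom a j))) (upTo (suc (deg (ms ∷ʳ suc t))))
  }

∸-suc : ∀ {j t} → t ℕ.< j → j ℕ.∸ t ≡ suc (j ℕ.∸ suc t)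
∸-suc {suc j} {zero}  _           = refl
∸-suc {suc j} {suc t} (ℕ.s≤s t<j) = ∸-suc t<j

module _ {N} {L : PS (suc N)} {L′ : PS N} (plusVar : IsLiftPlusNewVar L L′) where
  open IsLiftPlusNewVar plusVar

  ^ˢ-lastCoeff : ∀ j t → lastCoeff (L ^ˢ j) t ≗ binom (ℕ→ℚ j) t · (L′ ^ˢ (j ℕ.∸ t))
  ^ˢ-lastCoeff zero zero    ms = trans (IsLift.lastCoeff-0 oneS-lift ms) (sym (ℚ.*-identityˡ (oneS ms)))
  ^ˢ-lastCoeff zero (suc t) ms = begin
    oneS (ms ∷ʳ suc t)         ≡⟨ IsLift.lastCoeff-suc oneS-lift t ms ⟩
    0ℚ                         ≡⟨ ℚ.*-zeroˡ (oneS ms) ⟨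
    0ℚ * oneS ms               ≡⟨ cong (_* oneS ms) (binom-vanishes {0} {suc t} (ℕ.s≤s ℕ.z≤n)) ⟨
    binom 0ℚ (suc t) * oneS ms ∎
  ^ˢ-lastCoeff (suc j) zero ms = begin
    (L ⊛ (L ^ˢ j)) (ms ∷ʳ 0)                             ≡⟨ ⊛-lastCoeff L (L ^ˢ j) ms 0 ⟩
    (lastCoeff L 0 ⊛ lastCoeff (L ^ˢ j) 0) ms            ≡⟨ ⊛-cong lastCoeff-0 (^ˢ-lastCoeff j 0) ms ⟩
    (L′ ⊛ (binom (ℕ→ℚ j) 0 · (L′ ^ˢ j))) ms             ≡⟨ ⊛-·ʳ (binom (ℕ→ℚ j) 0) L′ (L′ ^ˢ j) ms ⟩
    binom (ℕ→ℚ (suc j)) 0 * (L′ ^ˢ suc j) ms             ∎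
  ^ˢ-lastCoeff (suc j) (suc t) ms = begin
    (L ⊛ P) (ms ∷ʳ suc t)
      ≡⟨ ⊛-lastCoeff L P ms (suc t) ⟩
    (lastCoeff L 0 ⊛ lastCoeff P (suc t)) ms
      + antidiagonalSum (λ i i′ → (lastCoeff L (suc i) ⊛ lastCoeff P i′) ms) t
      ≡⟨ cong ((lastCoeff L 0 ⊛ lastCoeff P (suc t)) ms +_)
              (antidiagonalSum-first _ (λ i i′ → ⊛-zeroˡ (lastCoeff P i′) (lastCoeff-2+ i) ms) t) ⟩
    (lastCoeff L 0 ⊛ lastCoeff P (suc t)) ms + (lastCoeff L 1 ⊛ lastCoeff P t) ms
      ≡⟨ cong₂ _+_ (⊛-cong lastCoeff-0 (^ˢ-lastCoeff j (suc t)) ms)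
                   (trans (⊛-cong lastCoeff-1 (^ˢ-lastCoeff j t) ms) (⊛-identityˡ _ ms)) ⟩
    (L′ ⊛ (A · (L′ ^ˢ (j ℕ.∸ suc t)))) ms + B * Y
      ≡⟨ cong (_+ B * Y) (⊛-·ʳ A L′ (L′ ^ˢ (j ℕ.∸ suc t)) ms) ⟩
    A * (L′ ^ˢ suc (j ℕ.∸ suc t)) ms + B * Y
      ≡⟨ cong (_+ B * Y) realign ⟩
    A * Y + B * Y
      ≡⟨ ℚ.*-distribʳ-+ Y A B ⟨
    (A + B) * Y
      ≡⟨ cong (_* Y) (binom-pascal (ℕ→ℚ j) t) ⟨
    binom (1ℚ + ℕ→ℚ j) (suc t) * Y
      ≡⟨ cong (λ x → binom x (suc t) * Y) (ℕ→ℚ-suc j) ⟨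
    binom (ℕ→ℚ (suc j)) (suc t) * Y ∎
    where
    P = L ^ˢ j
    A = binom (ℕ→ℚ j) (suc t)
    B = binom (ℕ→ℚ j) t
    Y = (L′ ^ˢ (j ℕ.∸ t)) ms
    realign : A * (L′ ^ˢ suc (j ℕ.∸ suc t)) ms ≡ A * Y
    realign with j ℕ.≤? t
    ... | yes j≤t = begin
      A * (L′ ^ˢ suc (j ℕ.∸ suc t)) ms  ≡⟨ cong (_* (L′ ^ˢ suc (j ℕ.∸ suc t)) ms) A≡0 ⟩
      0ℚ * (L′ ^ˢ suc (j ℕ.∸ suc t)) ms ≡⟨ ℚ.*-zeroˡ ((L′ ^ˢ suc (j ℕ.∸ suc t)) ms) ⟩
      0ℚ                                ≡⟨ ℚ.*-zeroˡ Y ⟨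
      0ℚ * Y                            ≡⟨ cong (_* Y) A≡0 ⟨
      A * Y                             ∎
      where A≡0 = binom-vanishes (ℕ.s≤s j≤t)
    ... | no  j≰t = cong (λ n → A * (L′ ^ˢ n) ms) (sym (∸-suc (ℕ.≰⇒> j≰t)))

  onePlusPow-lastCoeff : ∀ b t → lastCoeff (onePlusPow L b) t ≗ binom b t · onePlusPow L′ (b - ℕ→ℚ t)
  onePlusPow-lastCoeff b t ms = begin
    sumℚ (map F (upTo (suc (deg (ms ∷ʳ t)))))
      ≡⟨ cong (λ n → sumℚ (map F (upTo n))) degree ⟩
    sumℚ (map F (upTo (t ℕ.+ suc (deg ms))))
      ≡⟨ sumℚ-map-cong (λ j → cong (binom b j *_) (^ˢ-lastCoeff j t ms)) (upTo (t ℕ.+ suc (deg ms))) ⟩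
    sumℚ (map F′ (upTo (t ℕ.+ suc (deg ms))))
      ≡⟨ sumℚ-upTo-+ F′ t (suc (deg ms)) ⟩
    sumℚ (map F′ (upTo t)) + sumℚ (map (λ i → F′ (t ℕ.+ i)) (upTo (suc (deg ms))))
      ≡⟨ cong₂ _+_ (sumℚ-upTo-zero F′ t low-terms) (sumℚ-map-cong high-terms (upTo (suc (deg ms)))) ⟩
    0ℚ + sumℚ (map (λ i → binom b t * (binom (b - ℕ→ℚ t) i * (L′ ^ˢ i) ms)) (upTo (suc (deg ms))))
      ≡⟨ ℚ.+-identityˡ _ ⟩
    sumℚ (map (λ i → binom b t * (binom (b - ℕ→ℚ t) i * (L′ ^ˢ i) ms)) (upTo (suc (deg ms))))
      ≡⟨ sumℚ-map-* (binom b t) (λ i → binom (b - ℕ→ℚ t) i * (L′ ^ˢ i) ms) (upTo (suc (deg ms))) ⟩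
    binom b t * onePlusPow L′ (b - ℕ→ℚ t) ms ∎
    where
    F F′ : ℕ → ℚ
    F  j = binom b j * (L ^ˢ j) (ms ∷ʳ t)
    F′ j = binom b j * (binom (ℕ→ℚ j) t * (L′ ^ˢ (j ℕ.∸ t)) ms)

    degree : suc (deg (ms ∷ʳ t)) ≡ t ℕ.+ suc (deg ms)
    degree = trans (cong suc (trans (deg-∷ʳ ms t) (ℕ.+-comm (deg ms) t))) (sym (ℕ.+-suc t (deg ms)))

    low-terms : ∀ j → j ℕ.< t → F′ j ≡ 0ℚ
    low-terms j j<t = begin
      binom b j * (binom (ℕ→ℚ j) t * (L′ ^ˢ (j ℕ.∸ t)) ms)
        ≡⟨ cong (λ u → binom b j * (u * (L′ ^ˢ (j ℕ.∸ t)) ms)) (binom-vanishes j<t) ⟩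
      binom b j * (0ℚ * (L′ ^ˢ (j ℕ.∸ t)) ms)
        ≡⟨ cong (binom b j *_) (ℚ.*-zeroˡ ((L′ ^ˢ (j ℕ.∸ t)) ms)) ⟩
      binom b j * 0ℚ
        ≡⟨ ℚ.*-zeroʳ (binom b j) ⟩
      0ℚ ∎

    high-terms : ∀ i → F′ (t ℕ.+ i) ≡ binom b t * (binom (b - ℕ→ℚ t) i * (L′ ^ˢ i) ms)
    high-terms i = begin
      binom b (t ℕ.+ i) * (binom (ℕ→ℚ (t ℕ.+ i)) t * (L′ ^ˢ (t ℕ.+ i ℕ.∸ t)) ms)
        ≡⟨ cong (λ n → binom b (t ℕ.+ i) * (binom (ℕ→ℚ (t ℕ.+ i)) t * (L′ ^ˢ n) ms)) (ℕ.m+n∸m≡n t i) ⟩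
      binom b (t ℕ.+ i) * (binom (ℕ→ℚ (t ℕ.+ i)) t * (L′ ^ˢ i) ms)
        ≡⟨ ℚ.*-assoc (binom b (t ℕ.+ i)) _ _ ⟨
      binom b (t ℕ.+ i) * binom (ℕ→ℚ (t ℕ.+ i)) t * (L′ ^ˢ i) ms
        ≡⟨ cong (_* (L′ ^ˢ i) ms) (binom-trinomial b t i) ⟩
      binom b t * binom (b - ℕ→ℚ t) i * (L′ ^ˢ i) ms
        ≡⟨ ℚ.*-assoc (binom b t) _ _ ⟩
      binom b t * (binom (b - ℕ→ℚ t) i * (L′ ^ˢ i) ms) ∎

-- The variables

onlyIf : Bool → ℚ → ℚ
onlyIf b x = if b then x else 0ℚ

onlyIf-zero : ∀ b → onlyIf b 0ℚ ≡ 0ℚ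
onlyIf-zero true  = refl
onlyIf-zero false = refl

sumℚ-map-filter : ∀ {A : Set} {ℓ} {P : Pred A ℓ} (P? : Decidable P) (F : A → ℚ) xs →
  sumℚ (map F (filter P? xs)) ≡ sumℚ (map (λ x → onlyIf (does (P? x)) (F x)) xs)
sumℚ-map-filter P? F []       = refl
sumℚ-map-filter P? F (x ∷ xs) with does (P? x)
... | true  = cong (F x +_) (sumℚ-map-filter P? F xs)
... | false = trans (sumℚ-map-filter P? F xs) (sym (ℚ.+-identityˡ _))

tabulate-∷ʳ : ∀ {A : Set} {n} (f : Fin (suc n) → A) → Vec.tabulate f ≡ Vec.tabulate (f ∘ inject₁) ∷ʳ f (fromℕ n)
tabulate-∷ʳ {n = zero}  f = refl
tabulate-∷ʳ {n = suc n} f = cong (f zero ∷_) (tabulate-∷ʳ (f ∘ suc))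

map-allFin-∷ʳ : ∀ {A : Set} n (f : Fin (suc n) → A) →
  map f (allFin (suc n)) ≡ map (f ∘ inject₁) (allFin n) ++ (f (fromℕ n) ∷ [])
map-allFin-∷ʳ n f = begin
  map f (allFin (suc n))                              ≡⟨ List.map-tabulate (λ i → i) f ⟩
  List.tabulate f                                     ≡⟨ tabulate-++ n f ⟩
  List.tabulate (f ∘ inject₁) ++ (f (fromℕ n) ∷ [])   ≡⟨ cong (_++ (f (fromℕ n) ∷ [])) (List.map-tabulate (λ i → i) (f ∘ inject₁)) ⟨
  map (f ∘ inject₁) (allFin n) ++ (f (fromℕ n) ∷ [])  ∎
  where
  tabulate-++ : ∀ {A : Set} n (f : Fin (suc n) → A) →
    List.tabulate f ≡ List.tabulate (f ∘ inject₁) ++ (f (fromℕ n) ∷ [])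
  tabulate-++ zero    f = refl
  tabulate-++ (suc n) f = cong (f zero ∷_) (tabulate-++ n (f ∘ suc))

sumℚ-map-allFin-∷ʳ : ∀ n (F : Fin (suc n) → ℚ) →
  sumℚ (map F (allFin (suc n))) ≡ sumℚ (map (F ∘ inject₁) (allFin n)) + F (fromℕ n)
sumℚ-map-allFin-∷ʳ n F = begin
  sumℚ (map F (allFin (suc n)))                                  ≡⟨ cong sumℚ (map-allFin-∷ʳ n F) ⟩
  sumℚ (map (F ∘ inject₁) (allFin n) ++ (F (fromℕ n) ∷ []))        ≡⟨ sumℚ-++ (map (F ∘ inject₁) (allFin n)) _ ⟩
  sumℚ (map (F ∘ inject₁) (allFin n)) + (F (fromℕ n) + 0ℚ)         ≡⟨ cong (sumℚ (map (F ∘ inject₁) (allFin n)) +_) (ℚ.+-identityʳ _) ⟩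
  sumℚ (map (F ∘ inject₁) (allFin n)) + F (fromℕ n)                ∎

sumWhere : ∀ {N} → (Fin N → Bool) → (Fin N → ℚ) → ℚ
sumWhere {N} S F = sumℚ (map (λ i → onlyIf (S i) (F i)) (allFin N))

sumℚ-map-filter-allFin : ∀ {N ℓ} {P : Pred (Fin N) ℓ} (P? : Decidable P) (F : Fin N → ℚ) →
  sumℚ (map F (filter P? (allFin N))) ≡ sumWhere (does ∘ P?) F
sumℚ-map-filter-allFin {N} P? F = sumℚ-map-filter P? F (allFin N)

sumWhere-cong : ∀ {N} {S S′ : Fin N → Bool} {F F′ : Fin N → ℚ} → S ≗ S′ → F ≗ F′ → sumWhere S F ≡ sumWhere S′ F′
sumWhere-cong {N} S≗S′ F≗F′ = sumℚ-map-cong (λ i → cong₂ onlyIf (S≗S′ i) (F≗F′ i)) (allFin N)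

sumWhere-zero : ∀ {N} (S : Fin N → Bool) {F : Fin N → ℚ} → (∀ i → S i ≡ false ⊎ F i ≡ 0ℚ) → sumWhere S F ≡ 0ℚ
sumWhere-zero {N} S {F} vanish = sumℚ-map-zero term-zero (allFin N)
  where
  term-zero : ∀ i → onlyIf (S i) (F i) ≡ 0ℚ
  term-zero i with vanish i
  ... | inj₁ Si≡false = cong (λ b → onlyIf b (F i)) Si≡false
  ... | inj₂ Fi≡0     = trans (cong (onlyIf (S i)) Fi≡0) (onlyIf-zero (S i))

sumWhere-∷ʳ : ∀ {n} (S : Fin (suc n) → Bool) F →
  sumWhere S F ≡ sumWhere (S ∘ inject₁) (F ∘ inject₁) + onlyIf (S (fromℕ n)) (F (fromℕ n))
sumWhere-∷ʳ {n} S F = sumℚ-map-allFin-∷ʳ n (λ i → onlyIf (S i) (F i))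

toℕ-inject₁<toℕ-fromℕ : ∀ {N} (i : Fin N) → toℕ (inject₁ i) ℕ.< toℕ (fromℕ N)
toℕ-inject₁<toℕ-fromℕ {N} i = subst₂ ℕ._<_ (sym (Fin.toℕ-inject₁ i)) (sym (Fin.toℕ-fromℕ N)) (Fin.toℕ<n i)

-- var i k and oneS k unfold to indicator k (unitMono i) and indicator k zeroMono.
indicator : ∀ {N} → Mono N → Mono N → ℚ
indicator x y = if does (Vec.≡-dec ℕ._≟_ x y) then 1ℚ else 0ℚ

indicator-≡ : ∀ {N} (x : Mono N) → indicator x x ≡ 1ℚ
indicator-≡ x = cong (λ b → if b then 1ℚ else 0ℚ) (dec-true (Vec.≡-dec ℕ._≟_ x x) refl)

indicator-≢ : ∀ {N} {x y : Mono N} → x ≢ y → indicator x y ≡ 0ℚ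
indicator-≢ {x = x} {y} x≢y = cong (λ b → if b then 1ℚ else 0ℚ) (dec-false (Vec.≡-dec ℕ._≟_ x y) x≢y)

indicator-∷ʳ : ∀ {N} (xs ys : Mono N) a → indicator (xs ∷ʳ a) (ys ∷ʳ a) ≡ indicator xs ys
indicator-∷ʳ xs ys a with Vec.≡-dec ℕ._≟_ xs ys
... | yes refl  = indicator-≡ (xs ∷ʳ a)
... | no  xs≢ys = indicator-≢ (xs≢ys ∘ Vec.∷ʳ-injectiveˡ xs ys)

indicator-∷ʳ-≢ : ∀ {N} (xs ys : Mono N) {a b} → a ≢ b → indicator (xs ∷ʳ a) (ys ∷ʳ b) ≡ 0ℚ
indicator-∷ʳ-≢ xs ys a≢b = indicator-≢ (a≢b ∘ Vec.∷ʳ-injectiveʳ xs ys)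

unitEntry : ∀ {N} → Fin N → Fin N → ℕ
unitEntry i j = if does (toℕ i ℕ.≟ toℕ j) then 1 else 0

unitEntry-≢ : ∀ {N} {i j : Fin N} → toℕ i ≢ toℕ j → unitEntry i j ≡ 0
unitEntry-≢ {i = i} {j} i≢j = cong (λ b → if b then 1 else 0) (dec-false (toℕ i ℕ.≟ toℕ j) i≢j)

unitMono-inject₁ : ∀ {N} (i : Fin N) → unitMono (inject₁ i) ≡ unitMono i ∷ʳ 0
unitMono-inject₁ {N} i = trans (tabulate-∷ʳ (unitEntry (inject₁ i)))
  (cong₂ _∷ʳ_ (Vec.tabulate-cong λ j → cong₂ (λ x y → if does (x ℕ.≟ y) then 1 else 0)
                                             (Fin.toℕ-inject₁ i) (Fin.toℕ-inject₁ j))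
              (unitEntry-≢ (ℕ.<⇒≢ (toℕ-inject₁<toℕ-fromℕ i))))

unitMono-fromℕ : ∀ N → unitMono (fromℕ N) ≡ zeroMono {N} ∷ʳ 1
unitMono-fromℕ N = trans (tabulate-∷ʳ (unitEntry (fromℕ N)))
  (cong₂ _∷ʳ_ (begin
      Vec.tabulate (unitEntry (fromℕ N) ∘ inject₁) ≡⟨ Vec.tabulate-cong (λ j → unitEntry-≢ (ℕ.>⇒≢ (toℕ-inject₁<toℕ-fromℕ j))) ⟩
      Vec.tabulate (const 0)                      ≡⟨ Vec.tabulate-allFin (const 0) ⟩
      Vec.map (const 0) (Vec.allFin N)            ≡⟨ Vec.map-const (Vec.allFin N) 0 ⟩
      zeroMono                                    ∎)
    (cong (λ b → if b then 1 else 0) (dec-true (toℕ (fromℕ N) ℕ.≟ toℕ (fromℕ N)) refl)))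

var-inject₁-lift : ∀ {N} (i : Fin N) → IsLift (var (inject₁ i)) (var i)
var-inject₁-lift i = record
  { lastCoeff-0   = λ ms → trans (cong (indicator (ms ∷ʳ 0)) (unitMono-inject₁ i)) (indicator-∷ʳ ms (unitMono i) 0)
  ; lastCoeff-suc = λ t ms → trans (cong (indicator (ms ∷ʳ suc t)) (unitMono-inject₁ i))
                                   (indicator-∷ʳ-≢ ms (unitMono i) λ ())
  }

module _ (N : ℕ) (ms : Mono N) where
  private lastVar = var (fromℕ N)

  var-fromℕ-lastCoeff-0 : lastVar (ms ∷ʳ 0) ≡ 0ℚ
  var-fromℕ-lastCoeff-0 = trans (cong (indicator (ms ∷ʳ 0)) (unitMono-fromℕ N)) (indicator-∷ʳ-≢ ms zeroMono λ ())

  var-fromℕ-lastCoeff-1 : lastVar (ms ∷ʳ 1) ≡ oneS ms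
  var-fromℕ-lastCoeff-1 = trans (cong (indicator (ms ∷ʳ 1)) (unitMono-fromℕ N)) (indicator-∷ʳ ms zeroMono 1)

  var-fromℕ-lastCoeff-2+ : ∀ t → lastVar (ms ∷ʳ suc (suc t)) ≡ 0ℚ
  var-fromℕ-lastCoeff-2+ t =
    trans (cong (indicator (ms ∷ʳ suc (suc t))) (unitMono-fromℕ N)) (indicator-∷ʳ-≢ ms zeroMono λ ())

varSum : ∀ {N} → (Fin N → Bool) → PS N
varSum S k = sumWhere S (λ i → var i k)

varSum-cong : ∀ {N} {S S′ : Fin N → Bool} → S ≗ S′ → varSum S ≗ varSum S′
varSum-cong S≗S′ k = sumWhere-cong S≗S′ (λ _ → refl)

module _ {N} (S : Fin (suc N) → Bool) (ms : Mono N) where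
  private
    lowerSum : ℕ → ℚ
    lowerSum t = sumWhere (S ∘ inject₁) (λ i → var (inject₁ i) (ms ∷ʳ t))

    lowerSum-suc : ∀ t → lowerSum (suc t) ≡ 0ℚ
    lowerSum-suc t = sumWhere-zero (S ∘ inject₁) (λ i → inj₂ (IsLift.lastCoeff-suc (var-inject₁-lift i) t ms))

    split : ∀ t → varSum S (ms ∷ʳ t) ≡ lowerSum t + onlyIf (S (fromℕ N)) (var (fromℕ N) (ms ∷ʳ t))
    split t = sumWhere-∷ʳ S (λ i → var i (ms ∷ʳ t))

  varSum-lastCoeff-0 : varSum S (ms ∷ʳ 0) ≡ varSum (S ∘ inject₁) ms
  varSum-lastCoeff-0 = begin
    varSum S (ms ∷ʳ 0)
      ≡⟨ split 0 ⟩
    lowerSum 0 + onlyIf (S (fromℕ N)) (var (fromℕ N) (ms ∷ʳ 0))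
      ≡⟨ cong₂ _+_ (sumWhere-cong {S = S ∘ inject₁} (λ _ → refl) (λ i → IsLift.lastCoeff-0 (var-inject₁-lift i) ms))
                   (trans (cong (onlyIf (S (fromℕ N))) (var-fromℕ-lastCoeff-0 N ms)) (onlyIf-zero (S (fromℕ N)))) ⟩
    varSum (S ∘ inject₁) ms + 0ℚ
      ≡⟨ ℚ.+-identityʳ _ ⟩
    varSum (S ∘ inject₁) ms ∎

  varSum-lastCoeff-1 : varSum S (ms ∷ʳ 1) ≡ onlyIf (S (fromℕ N)) (oneS ms)
  varSum-lastCoeff-1 = trans (split 1)
    (trans (cong₂ _+_ (lowerSum-suc 0) (cong (onlyIf (S (fromℕ N))) (var-fromℕ-lastCoeff-1 N ms)))
           (ℚ.+-identityˡ _))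

  varSum-lastCoeff-2+ : ∀ t → varSum S (ms ∷ʳ suc (suc t)) ≡ 0ℚ
  varSum-lastCoeff-2+ t = trans (split (suc (suc t)))
    (cong₂ _+_ (lowerSum-suc (suc t))
               (trans (cong (onlyIf (S (fromℕ N))) (var-fromℕ-lastCoeff-2+ N ms t)) (onlyIf-zero (S (fromℕ N)))))

allVars : (N : ℕ) → PS N
allVars N = varSum (const true)

allVars-plusNewVar : ∀ N → IsLiftPlusNewVar (allVars (suc N)) (allVars N)
allVars-plusNewVar N = record
  { lastCoeff-0  = varSum-lastCoeff-0 (const true)
  ; lastCoeff-1  = varSum-lastCoeff-1 (const true)
  ; lastCoeff-2+ = λ t ms → varSum-lastCoeff-2+ (const true) ms t
  }

IsLiftPlusNewVar-resp-≗ : ∀ {N} {L₁ L₂ : PS (suc N)} {L′₁ L′₂ : PS N} →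
  L₁ ≗ L₂ → L′₁ ≗ L′₂ → IsLiftPlusNewVar L₁ L′₁ → IsLiftPlusNewVar L₂ L′₂
IsLiftPlusNewVar-resp-≗ L₁≗L₂ L′₁≗L′₂ plusVar = record
  { lastCoeff-0  = λ ms → trans (sym (L₁≗L₂ _)) (trans (lastCoeff-0 ms) (L′₁≗L′₂ ms))
  ; lastCoeff-1  = λ ms → trans (sym (L₁≗L₂ _)) (lastCoeff-1 ms)
  ; lastCoeff-2+ = λ t ms → trans (sym (L₁≗L₂ _)) (lastCoeff-2+ t ms)
  }
  where open IsLiftPlusNewVar plusVar

partialSumVars≗varSum : ∀ {N} (j : Fin N) → partialSumVars j ≗ varSum (λ i → does (toℕ i ℕ.≤? toℕ j))
partialSumVars≗varSum {N} j k = begin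
  foldr _⊕_ zeroS (map var below) k              ≡⟨ evaluate (map var below) ⟩
  sumℚ (map (λ f → f k) (map var below))         ≡⟨ cong sumℚ (List.map-∘ below) ⟨
  sumℚ (map (λ i → var i k) below)               ≡⟨ sumℚ-map-filter-allFin (λ i → toℕ i ℕ.≤? toℕ j) (λ i → var i k) ⟩
  varSum (λ i → does (toℕ i ℕ.≤? toℕ j)) k       ∎
  where
  below = filter (λ i → toℕ i ℕ.≤? toℕ j) (allFin N)
  evaluate : ∀ fs → foldr _⊕_ zeroS fs k ≡ sumℚ (map (λ f → f k) fs)
  evaluate []       = refl
  evaluate (f ∷ fs) = cong (f k +_) (evaluate fs)

partialSumVars-inject₁-lift : ∀ {N} (j : Fin N) → IsLift (partialSumVars (inject₁ j)) (partialSumVars j)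
partialSumVars-inject₁-lift {N} j = record
  { lastCoeff-0   = λ ms → begin
      partialSumVars (inject₁ j) (ms ∷ʳ 0)  ≡⟨ partialSumVars≗varSum (inject₁ j) (ms ∷ʳ 0) ⟩
      varSum S (ms ∷ʳ 0)                    ≡⟨ varSum-lastCoeff-0 S ms ⟩
      varSum (S ∘ inject₁) ms               ≡⟨ varSum-cong (λ i → cong₂ (λ x y → does (x ℕ.≤? y)) (Fin.toℕ-inject₁ i) (Fin.toℕ-inject₁ j)) ms ⟩
      varSum (λ i → does (toℕ i ℕ.≤? toℕ j)) ms ≡⟨ partialSumVars≗varSum j ms ⟨
      partialSumVars j ms                   ∎
  ; lastCoeff-suc = λ where
      zero ms → begin
        partialSumVars (inject₁ j) (ms ∷ʳ 1)  ≡⟨ partialSumVars≗varSum (inject₁ j) (ms ∷ʳ 1) ⟩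
        varSum S (ms ∷ʳ 1)                    ≡⟨ varSum-lastCoeff-1 S ms ⟩
        onlyIf (S (fromℕ N)) (oneS ms)        ≡⟨ cong (λ b → onlyIf b (oneS ms)) (dec-false (_ ℕ.≤? _) last∉S) ⟩
        0ℚ                                    ∎
      (suc t) ms → trans (partialSumVars≗varSum (inject₁ j) (ms ∷ʳ suc (suc t))) (varSum-lastCoeff-2+ S ms t)
  }
  where
  S = λ i → does (toℕ i ℕ.≤? toℕ (inject₁ j))
  last∉S : ¬ (toℕ (fromℕ N) ℕ.≤ toℕ (inject₁ j))
  last∉S = ℕ.<⇒≱ (toℕ-inject₁<toℕ-fromℕ j)

partialSumVars-fromℕ : ∀ n → partialSumVars (fromℕ n) ≗ allVars (suc n)
partialSumVars-fromℕ n k = trans (partialSumVars≗varSum (fromℕ n) k) (varSum-cong below-last k)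
  where
  below-last : ∀ i → does (toℕ i ℕ.≤? toℕ (fromℕ n)) ≡ true
  below-last i = dec-true (_ ℕ.≤? _) (subst (toℕ i ℕ.≤_) (sym (Fin.toℕ-fromℕ n)) (Fin.toℕ≤pred[n] i))

partialSumVars-plusNewVar : ∀ n → IsLiftPlusNewVar (partialSumVars (fromℕ (suc n))) (partialSumVars (fromℕ n))
partialSumVars-plusNewVar n = IsLiftPlusNewVar-resp-≗
  (sym ∘ partialSumVars-fromℕ (suc n)) (sym ∘ partialSumVars-fromℕ n) (allVars-plusNewVar (suc n))

-- Taking the coefficient of x_N^t on both sides reduces the law in N + 1
-- variables to the law in N variables and Vandermonde's identity.
onePlusPow-+ : ∀ N {L : PS N} → L ≗ allVars N → ∀ a c →
  (onePlusPow L a ⊛ onePlusPow L c) ≗ onePlusPow L (a + c)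
onePlusPow-+ zero    _ a c Vec.[] = refl
onePlusPow-+ (suc N) {L} L≗allVars a c k with Vec.initLast k
... | ms , t , refl = begin
  (onePlusPow L a ⊛ onePlusPow L c) (ms ∷ʳ t)
    ≡⟨ ⊛-lastCoeff (onePlusPow L a) (onePlusPow L c) ms t ⟩
  antidiagonalSum (λ i j → (lastCoeff (onePlusPow L a) i ⊛ lastCoeff (onePlusPow L c) j) ms) t
    ≡⟨ antidiagonalSum-cong t coefficient ⟩
  antidiagonalSum (λ i j → X * (binom a i * binom c j)) t
    ≡⟨ antidiagonalSum-* X _ t ⟩
  X * antidiagonalSum (λ i j → binom a i * binom c j) t
    ≡⟨ cong (X *_) (vandermonde a c t) ⟩
  X * binom (a + c) t
    ≡⟨ ℚ.*-comm X _ ⟩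
  binom (a + c) t * X
    ≡⟨ onePlusPow-lastCoeff plusVar (a + c) t ms ⟨
  onePlusPow L (a + c) (ms ∷ʳ t) ∎
  where
  plusVar : IsLiftPlusNewVar L (allVars N)
  plusVar = IsLiftPlusNewVar-resp-≗ (sym ∘ L≗allVars) (λ _ → refl) (allVars-plusNewVar N)

  X = onePlusPow (allVars N) ((a + c) - ℕ→ℚ t) ms

  exponents : ∀ a c x y → (a - x) + (c - y) ≡ (a + c) - (x + y)
  exponents = solve-∀ ℚ-ring
  rearrange : ∀ A C x → A * (C * x) ≡ x * (A * C)
  rearrange = solve-∀ ℚ-ring

  coefficient : ∀ i j → i ℕ.+ j ≡ t →
    (lastCoeff (onePlusPow L a) i ⊛ lastCoeff (onePlusPow L c) j) ms ≡ X * (binom a i * binom c j)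
  coefficient i j i+j≡t = begin
    (lastCoeff (onePlusPow L a) i ⊛ lastCoeff (onePlusPow L c) j) ms
      ≡⟨ ⊛-cong (onePlusPow-lastCoeff plusVar a i) (onePlusPow-lastCoeff plusVar c j) ms ⟩
    ((binom a i · Pa) ⊛ (binom c j · Pc)) ms
      ≡⟨ ⊛-·ˡ (binom a i) Pa _ ms ⟩
    binom a i * (Pa ⊛ (binom c j · Pc)) ms
      ≡⟨ cong (binom a i *_) (⊛-·ʳ (binom c j) Pa Pc ms) ⟩
    binom a i * (binom c j * (Pa ⊛ Pc) ms)
      ≡⟨ cong (λ u → binom a i * (binom c j * u)) (onePlusPow-+ N (λ _ → refl) (a - ℕ→ℚ i) (c - ℕ→ℚ j) ms) ⟩
    binom a i * (binom c j * onePlusPow (allVars N) ((a - ℕ→ℚ i) + (c - ℕ→ℚ j)) ms)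
      ≡⟨ cong (λ x → binom a i * (binom c j * onePlusPow (allVars N) x ms)) exponent ⟩
    binom a i * (binom c j * X)
      ≡⟨ rearrange (binom a i) (binom c j) X ⟩
    X * (binom a i * binom c j) ∎
    where
    Pa = onePlusPow (allVars N) (a - ℕ→ℚ i)
    Pc = onePlusPow (allVars N) (c - ℕ→ℚ j)
    exponent : (a - ℕ→ℚ i) + (c - ℕ→ℚ j) ≡ (a + c) - ℕ→ℚ t
    exponent = trans (exponents a c (ℕ→ℚ i) (ℕ→ℚ j))
                     (cong ((a + c) -_) (trans (sym (ℕ→ℚ-homo-+ i j)) (cong ℕ→ℚ i+j≡t)))

-- The recursion in the number of variables

foldr-⊛-cong : ∀ {N} {A : Set} {u v : A → PS N} {R R′ : PS N} → (∀ x → u x ≗ v x) → R ≗ R′ → ∀ xs →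
  foldr _⊛_ R (map u xs) ≗ foldr _⊛_ R′ (map v xs)
foldr-⊛-cong u≗v R≗R′ []       = R≗R′
foldr-⊛-cong u≗v R≗R′ (x ∷ xs) = ⊛-cong (u≗v x) (foldr-⊛-cong u≗v R≗R′ xs)

foldr-⊛-· : ∀ {N} {A : Set} (u : A → PS N) c R xs → foldr _⊛_ (c · R) (map u xs) ≗ c · foldr _⊛_ R (map u xs)
foldr-⊛-· u c R []       k = refl
foldr-⊛-· u c R (x ∷ xs) k = trans (⊛-cong {f = u x} (λ _ → refl) (foldr-⊛-· u c R xs) k)
                                   (⊛-·ʳ c (u x) (foldr _⊛_ R (map u xs)) k)

lastCoeff-foldr-⊛-lift : ∀ {N} {A : Set} (u : A → PS (suc N)) (v : A → PS N) → (∀ x → IsLift (u x) (v x)) →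
  ∀ R t xs → lastCoeff (foldr _⊛_ R (map u xs)) t ≗ foldr _⊛_ (lastCoeff R t) (map v xs)
lastCoeff-foldr-⊛-lift u v lift R t []       ms = refl
lastCoeff-foldr-⊛-lift u v lift R t (x ∷ xs) ms =
  trans (lastCoeff-⊛-lift (u x) (foldr _⊛_ R (map u xs)) (IsLift.lastCoeff-suc (lift x)) t ms)
        (⊛-cong (IsLift.lastCoeff-0 (lift x)) (lastCoeff-foldr-⊛-lift u v lift R t xs) ms)

prodS-map-allFin-∷ʳ : ∀ {N} n (f : Fin (suc n) → PS N) →
  prodS (map f (allFin (suc n))) ≡ foldr _⊛_ (f (fromℕ n) ⊛ oneS) (map (f ∘ inject₁) (allFin n))
prodS-map-allFin-∷ʳ n f =
  trans (cong prodS (map-allFin-∷ʳ n f)) (List.foldr-++ _⊛_ oneS (map (f ∘ inject₁) (allFin n)) _)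

addToLast : ∀ {n} → (Fin (suc n) → ℚ) → ℚ → Fin (suc n) → ℚ
addToLast {zero}  f x zero    = f zero + x
addToLast {suc n} f x zero    = f zero
addToLast {suc n} f x (suc i) = addToLast (f ∘ suc) x i

addToLast-inject₁ : ∀ {n} (f : Fin (suc n) → ℚ) x i → addToLast f x (inject₁ i) ≡ f (inject₁ i)
addToLast-inject₁ {suc n} f x zero    = refl
addToLast-inject₁ {suc n} f x (suc i) = addToLast-inject₁ (f ∘ suc) x i

addToLast-fromℕ : ∀ {n} (f : Fin (suc n) → ℚ) x → addToLast f x (fromℕ n) ≡ f (fromℕ n) + x
addToLast-fromℕ {zero}  f x = refl
addToLast-fromℕ {suc n} f x = addToLast-fromℕ (f ∘ suc) x

-- Extracting x^t, x the last variable, from the last factor (1 + L + x)^{b_last} leaves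
-- binom(b_last, t) (1 + L)^{b_last - t}, which merges into the previous factor (1 + L)^{b_{last-1}}.
mergeLast : ∀ {n} → (Fin (suc (suc n)) → ℚ) → ℕ → Fin (suc n) → ℚ
mergeLast {n} b t = addToLast (b ∘ inject₁) (b (fromℕ (suc n)) - ℕ→ℚ t)

module _ (n : ℕ) (b : Fin (suc (suc n)) → ℚ) (t : ℕ) where
  private
    last = fromℕ (suc n)
    c = binom (b last) t

    factor : Fin (suc (suc n)) → PS (suc (suc n))
    factor j = onePlusPow (partialSumVars j) (b j)

    lowered merged : Fin (suc n) → PS (suc n)
    lowered j = onePlusPow (partialSumVars j) (b (inject₁ j))
    merged  j = onePlusPow (partialSumVars j) (mergeLast b t j)

    rest : PS (suc n)
    rest = onePlusPow (partialSumVars (fromℕ n)) (b last - ℕ→ℚ t)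

    last-factor : lastCoeff (factor last ⊛ oneS) t ≗ c · rest
    last-factor ms = trans (⊛-identityʳ (factor last) (ms ∷ʳ t))
                           (onePlusPow-lastCoeff (partialSumVars-plusNewVar n) (b last) t ms)

    merge-seed : (lowered (fromℕ n) ⊛ rest) ≗ (merged (fromℕ n) ⊛ oneS)
    merge-seed k = begin
      (lowered (fromℕ n) ⊛ rest) k
        ≡⟨ onePlusPow-+ (suc n) (partialSumVars-fromℕ n) (b (inject₁ (fromℕ n))) (b last - ℕ→ℚ t) k ⟩
      onePlusPow (partialSumVars (fromℕ n)) (b (inject₁ (fromℕ n)) + (b last - ℕ→ℚ t)) k
        ≡⟨ cong (λ x → onePlusPow (partialSumVars (fromℕ n)) x k) (addToLast-fromℕ (b ∘ inject₁) _) ⟨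
      merged (fromℕ n) k
        ≡⟨ ⊛-identityʳ (merged (fromℕ n)) k ⟨
      (merged (fromℕ n) ⊛ oneS) k ∎

    merge : foldr _⊛_ rest (map lowered (allFin (suc n))) ≗ theSeries (mergeLast b t)
    merge k = begin
      foldr _⊛_ rest (map lowered (allFin (suc n))) k
        ≡⟨ cong (λ P → foldr _⊛_ rest P k) (map-allFin-∷ʳ n lowered) ⟩
      foldr _⊛_ rest (map (lowered ∘ inject₁) (allFin n) ++ (lowered (fromℕ n) ∷ [])) k
        ≡⟨ cong (λ P → P k) (List.foldr-++ _⊛_ rest (map (lowered ∘ inject₁) (allFin n)) _) ⟩
      foldr _⊛_ (lowered (fromℕ n) ⊛ rest) (map (lowered ∘ inject₁) (allFin n)) k
        ≡⟨ foldr-⊛-cong unchanged merge-seed (allFin n) k ⟩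
      foldr _⊛_ (merged (fromℕ n) ⊛ oneS) (map (merged ∘ inject₁) (allFin n)) k
        ≡⟨ cong (λ P → P k) (prodS-map-allFin-∷ʳ n merged) ⟨
      theSeries (mergeLast b t) k ∎
      where
      unchanged : ∀ j → lowered (inject₁ j) ≗ merged (inject₁ j)
      unchanged j k = cong (λ x → onePlusPow (partialSumVars (inject₁ j)) x k)
                           (sym (addToLast-inject₁ (b ∘ inject₁) _ j))

  theSeries-lastCoeff : lastCoeff (theSeries b) t ≗ c · theSeries (mergeLast b t)
  theSeries-lastCoeff ms = begin
    theSeries b (ms ∷ʳ t)
      ≡⟨ cong (λ P → P (ms ∷ʳ t)) (prodS-map-allFin-∷ʳ (suc n) factor) ⟩
    foldr _⊛_ (factor last ⊛ oneS) (map (factor ∘ inject₁) (allFin (suc n))) (ms ∷ʳ t)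
      ≡⟨ lastCoeff-foldr-⊛-lift (factor ∘ inject₁) lowered
           (λ j → onePlusPow-lift (partialSumVars-inject₁-lift j) (b (inject₁ j)))
           (factor last ⊛ oneS) t (allFin (suc n)) ms ⟩
    foldr _⊛_ (lastCoeff (factor last ⊛ oneS) t) (map lowered (allFin (suc n))) ms
      ≡⟨ foldr-⊛-cong {u = lowered} (λ _ _ → refl) last-factor (allFin (suc n)) ms ⟩
    foldr _⊛_ (c · rest) (map lowered (allFin (suc n))) ms
      ≡⟨ foldr-⊛-· lowered c rest (allFin (suc n)) ms ⟩
    c * foldr _⊛_ rest (map lowered (allFin (suc n))) ms
      ≡⟨ cong (c *_) (merge ms) ⟩
    c * theSeries (mergeLast b t) ms ∎

sumFrom≡sumWhere : ∀ {N} (b : Fin N → ℚ) j → sumFrom b j ≡ sumWhere (λ i → does (toℕ j ℕ.≤? toℕ i)) b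
sumFrom≡sumWhere b j = sumℚ-map-filter-allFin (λ i → toℕ j ℕ.≤? toℕ i) b

sumAfter≡sumWhere : ∀ {N} (k : Fin N → ℕ) j → sumAfter k j ≡ sumWhere (λ i → does (toℕ j ℕ.<? toℕ i)) (ℕ→ℚ ∘ k)
sumAfter≡sumWhere k j = sumℚ-map-filter-allFin (λ i → toℕ j ℕ.<? toℕ i) (ℕ→ℚ ∘ k)

module _ {m} (j : Fin m) where
  private
    j<last : toℕ (inject₁ j) ℕ.< toℕ (fromℕ m)
    j<last = toℕ-inject₁<toℕ-fromℕ j

    compare-inject₁ : ∀ (R : ℕ → ℕ → Bool) (i : Fin m) → R (toℕ (inject₁ j)) (toℕ (inject₁ i)) ≡ R (toℕ j) (toℕ i)
    compare-inject₁ R i = cong₂ R (Fin.toℕ-inject₁ j) (Fin.toℕ-inject₁ i)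

  sumFrom-inject₁ : ∀ (b : Fin (suc m) → ℚ) → sumFrom b (inject₁ j) ≡ sumFrom (b ∘ inject₁) j + b (fromℕ m)
  sumFrom-inject₁ b = begin
    sumFrom b (inject₁ j)
      ≡⟨ sumFrom≡sumWhere b (inject₁ j) ⟩
    sumWhere (λ i → does (toℕ (inject₁ j) ℕ.≤? toℕ i)) b
      ≡⟨ sumWhere-∷ʳ (λ i → does (toℕ (inject₁ j) ℕ.≤? toℕ i)) b ⟩
    sumWhere (λ i → does (toℕ (inject₁ j) ℕ.≤? toℕ (inject₁ i))) (b ∘ inject₁)
      + onlyIf (does (toℕ (inject₁ j) ℕ.≤? toℕ (fromℕ m))) (b (fromℕ m))
      ≡⟨ cong₂ _+_ (sumWhere-cong {F = b ∘ inject₁} (compare-inject₁ (λ x y → does (x ℕ.≤? y))) (λ _ → refl))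
                   (cong (λ x → onlyIf x (b (fromℕ m))) (dec-true (toℕ (inject₁ j) ℕ.≤? toℕ (fromℕ m)) (ℕ.<⇒≤ j<last))) ⟩
    sumWhere (λ i → does (toℕ j ℕ.≤? toℕ i)) (b ∘ inject₁) + b (fromℕ m)
      ≡⟨ cong (_+ b (fromℕ m)) (sumFrom≡sumWhere (b ∘ inject₁) j) ⟨
    sumFrom (b ∘ inject₁) j + b (fromℕ m) ∎

  sumAfter-inject₁ : ∀ (k : Fin (suc m) → ℕ) →
    sumAfter k (inject₁ j) ≡ sumAfter (k ∘ inject₁) j + ℕ→ℚ (k (fromℕ m))
  sumAfter-inject₁ k = begin
    sumAfter k (inject₁ j)
      ≡⟨ sumAfter≡sumWhere k (inject₁ j) ⟩
    sumWhere (λ i → does (toℕ (inject₁ j) ℕ.<? toℕ i)) (ℕ→ℚ ∘ k)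
      ≡⟨ sumWhere-∷ʳ (λ i → does (toℕ (inject₁ j) ℕ.<? toℕ i)) (ℕ→ℚ ∘ k) ⟩
    sumWhere (λ i → does (toℕ (inject₁ j) ℕ.<? toℕ (inject₁ i))) (ℕ→ℚ ∘ k ∘ inject₁)
      + onlyIf (does (toℕ (inject₁ j) ℕ.<? toℕ (fromℕ m))) (ℕ→ℚ (k (fromℕ m)))
      ≡⟨ cong₂ _+_ (sumWhere-cong {F = ℕ→ℚ ∘ k ∘ inject₁} (compare-inject₁ (λ x y → does (x ℕ.<? y))) (λ _ → refl))
                   (cong (λ x → onlyIf x (ℕ→ℚ (k (fromℕ m)))) (dec-true (toℕ (inject₁ j) ℕ.<? toℕ (fromℕ m)) j<last)) ⟩
    sumWhere (λ i → does (toℕ j ℕ.<? toℕ i)) (ℕ→ℚ ∘ k ∘ inject₁) + ℕ→ℚ (k (fromℕ m))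
      ≡⟨ cong (_+ ℕ→ℚ (k (fromℕ m))) (sumAfter≡sumWhere (k ∘ inject₁) j) ⟨
    sumAfter (k ∘ inject₁) j + ℕ→ℚ (k (fromℕ m)) ∎

sumFrom-fromℕ : ∀ {m} (b : Fin (suc m) → ℚ) → sumFrom b (fromℕ m) ≡ b (fromℕ m)
sumFrom-fromℕ {m} b = begin
  sumFrom b (fromℕ m)
    ≡⟨ trans (sumFrom≡sumWhere b (fromℕ m)) (sumWhere-∷ʳ (λ i → does (toℕ (fromℕ m) ℕ.≤? toℕ i)) b) ⟩
  sumWhere (λ i → does (toℕ (fromℕ m) ℕ.≤? toℕ (inject₁ i))) (b ∘ inject₁)
    + onlyIf (does (toℕ (fromℕ m) ℕ.≤? toℕ (fromℕ m))) (b (fromℕ m))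
    ≡⟨ cong₂ _+_ (sumWhere-zero (λ i → does (toℕ (fromℕ m) ℕ.≤? toℕ (inject₁ i)))
                   (λ i → inj₁ (dec-false (toℕ (fromℕ m) ℕ.≤? toℕ (inject₁ i)) (ℕ.<⇒≱ (toℕ-inject₁<toℕ-fromℕ i)))))
                 (cong (λ x → onlyIf x (b (fromℕ m))) (dec-true (toℕ (fromℕ m) ℕ.≤? toℕ (fromℕ m)) ℕ.≤-refl)) ⟩
  0ℚ + b (fromℕ m)
    ≡⟨ ℚ.+-identityˡ _ ⟩
  b (fromℕ m) ∎

sumAfter-fromℕ : ∀ {m} (k : Fin (suc m) → ℕ) → sumAfter k (fromℕ m) ≡ 0ℚ
sumAfter-fromℕ {m} k = begin
  sumAfter k (fromℕ m)
    ≡⟨ trans (sumAfter≡sumWhere k (fromℕ m)) (sumWhere-∷ʳ (λ i → does (toℕ (fromℕ m) ℕ.<? toℕ i)) (ℕ→ℚ ∘ k)) ⟩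
  sumWhere (λ i → does (toℕ (fromℕ m) ℕ.<? toℕ (inject₁ i))) (ℕ→ℚ ∘ k ∘ inject₁)
    + onlyIf (does (toℕ (fromℕ m) ℕ.<? toℕ (fromℕ m))) (ℕ→ℚ (k (fromℕ m)))
    ≡⟨ cong₂ _+_ (sumWhere-zero (λ i → does (toℕ (fromℕ m) ℕ.<? toℕ (inject₁ i)))
                   (λ i → inj₁ (dec-false (toℕ (fromℕ m) ℕ.<? toℕ (inject₁ i)) (ℕ.<-asym (toℕ-inject₁<toℕ-fromℕ i)))))
                 (cong (λ x → onlyIf x (ℕ→ℚ (k (fromℕ m)))) (dec-false (toℕ (fromℕ m) ℕ.<? toℕ (fromℕ m)) (ℕ.<-irrefl refl))) ⟩
  0ℚ + 0ℚ
    ≡⟨⟩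
  0ℚ ∎

sumFrom-addToLast : ∀ {m} (f : Fin (suc m) → ℚ) x j → sumFrom (addToLast f x) j ≡ sumFrom f j + x
sumFrom-addToLast {m} f x j = begin
  sumFrom (addToLast f x) j
    ≡⟨ split (addToLast f x) ⟩
  sumWhere (S ∘ inject₁) (addToLast f x ∘ inject₁) + onlyIf (S (fromℕ m)) (addToLast f x (fromℕ m))
    ≡⟨ cong₂ _+_ (sumWhere-cong {S = S ∘ inject₁} (λ _ → refl) (addToLast-inject₁ f x))
                 (trans (cong (λ s → onlyIf s (addToLast f x (fromℕ m))) S-last) (addToLast-fromℕ f x)) ⟩
  sumWhere (S ∘ inject₁) (f ∘ inject₁) + (f (fromℕ m) + x)
    ≡⟨ ℚ.+-assoc (sumWhere (S ∘ inject₁) (f ∘ inject₁)) (f (fromℕ m)) x ⟨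
  sumWhere (S ∘ inject₁) (f ∘ inject₁) + f (fromℕ m) + x
    ≡⟨ cong (λ s → sumWhere (S ∘ inject₁) (f ∘ inject₁) + onlyIf s (f (fromℕ m)) + x) S-last ⟨
  sumWhere (S ∘ inject₁) (f ∘ inject₁) + onlyIf (S (fromℕ m)) (f (fromℕ m)) + x
    ≡⟨ cong (_+ x) (split f) ⟨
  sumFrom f j + x ∎
  where
  S = λ i → does (toℕ j ℕ.≤? toℕ i)
  split : ∀ g → sumFrom g j ≡ sumWhere (S ∘ inject₁) (g ∘ inject₁) + onlyIf (S (fromℕ m)) (g (fromℕ m))
  split g = trans (sumFrom≡sumWhere g j) (sumWhere-∷ʳ S g)
  S-last : S (fromℕ m) ≡ true
  S-last = dec-true (toℕ j ℕ.≤? toℕ (fromℕ m)) (subst (toℕ j ℕ.≤_) (sym (Fin.toℕ-fromℕ m)) (Fin.toℕ≤pred[n] j))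

prodℚ-map-allFin-∷ʳ : ∀ n (F : Fin (suc n) → ℚ) →
  prodℚ (map F (allFin (suc n))) ≡ prodℚ (map (F ∘ inject₁) (allFin n)) * F (fromℕ n)
prodℚ-map-allFin-∷ʳ n F = begin
  prodℚ (map F (allFin (suc n)))                        ≡⟨ cong prodℚ (map-allFin-∷ʳ n F) ⟩
  prodℚ (map (F ∘ inject₁) (allFin n) ++ (F (fromℕ n) ∷ [])) ≡⟨ List.foldr-++ _*_ 1ℚ (map (F ∘ inject₁) (allFin n)) _ ⟩
  foldr _*_ (F (fromℕ n) * 1ℚ) (map (F ∘ inject₁) (allFin n)) ≡⟨ foldr-* (map (F ∘ inject₁) (allFin n)) _ ⟩
  prodℚ (map (F ∘ inject₁) (allFin n)) * (F (fromℕ n) * 1ℚ)  ≡⟨ cong (prodℚ (map (F ∘ inject₁) (allFin n)) *_) (ℚ.*-identityʳ _) ⟩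
  prodℚ (map (F ∘ inject₁) (allFin n)) * F (fromℕ n)         ∎
  where
  foldr-* : ∀ xs y → foldr _*_ y xs ≡ prodℚ xs * y
  foldr-* []       y = sym (ℚ.*-identityˡ y)
  foldr-* (x ∷ xs) y = trans (cong (x *_) (foldr-* xs y)) (sym (ℚ.*-assoc x _ y))

closedForm-∷ʳ : ∀ n (b : Fin (suc (suc n)) → ℚ) (k : Fin (suc (suc n)) → ℕ) →
  let last = fromℕ (suc n) in
  closedForm b k ≡ closedForm (mergeLast b (k last)) (k ∘ inject₁) * binom (b last) (k last)
closedForm-∷ʳ n b k = trans (prodℚ-map-allFin-∷ʳ (suc n) factor)
  (cong₂ _*_ (cong prodℚ (List.map-cong factor-inject₁ (allFin (suc n))))
             (cong (λ x → binom x (k last)) last-upper))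
  where
  last = fromℕ (suc n)
  X = b last - ℕ→ℚ (k last)

  factor : Fin (suc (suc n)) → ℚ
  factor j = binom (sumFrom b j - sumAfter k j) (k j)

  last-upper : sumFrom b last - sumAfter k last ≡ b last
  last-upper = begin
    sumFrom b last - sumAfter k last  ≡⟨ cong₂ _-_ (sumFrom-fromℕ b) (sumAfter-fromℕ k) ⟩
    b last - 0ℚ                       ≡⟨ ℚ.+-identityʳ (b last) ⟩
    b last                            ∎

  regroup : ∀ S x A y → (S + x) - (A + y) ≡ (S + (x - y)) - A
  regroup = solve-∀ ℚ-ring

  factor-inject₁ : ∀ j → factor (inject₁ j)
                       ≡ binom (sumFrom (mergeLast b (k last)) j - sumAfter (k ∘ inject₁) j) (k (inject₁ j))
  factor-inject₁ j = cong (λ x → binom x (k (inject₁ j))) (begin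
    sumFrom b (inject₁ j) - sumAfter k (inject₁ j)
      ≡⟨ cong₂ _-_ (sumFrom-inject₁ j b) (sumAfter-inject₁ j k) ⟩
    (sumFrom (b ∘ inject₁) j + b last) - (sumAfter (k ∘ inject₁) j + ℕ→ℚ (k last))
      ≡⟨ regroup (sumFrom (b ∘ inject₁) j) (b last) (sumAfter (k ∘ inject₁) j) (ℕ→ℚ (k last)) ⟩
    (sumFrom (b ∘ inject₁) j + X) - sumAfter (k ∘ inject₁) j
      ≡⟨ cong (_- sumAfter (k ∘ inject₁) j) (sumFrom-addToLast (b ∘ inject₁) X j) ⟨
    sumFrom (mergeLast b (k last)) j - sumAfter (k ∘ inject₁) j ∎)

theSeries≡closedForm : ∀ n (b : Fin (suc n) → ℚ) (k : Fin (suc n) → ℕ) →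
  theSeries b (tabulate k) ≡ closedForm b k
theSeries≡closedForm zero b k = begin
  (onePlusPow (partialSumVars zero) (b zero) ⊛ oneS) ([] ∷ʳ k zero)
    ≡⟨ ⊛-identityʳ (onePlusPow (partialSumVars zero) (b zero)) ([] ∷ʳ k zero) ⟩
  onePlusPow (partialSumVars zero) (b zero) ([] ∷ʳ k zero)
    ≡⟨ onePlusPow-lastCoeff plusVar (b zero) (k zero) [] ⟩
  binom (b zero) (k zero) * 1ℚ
    ≡⟨ cong (λ x → binom x (k zero) * 1ℚ) (unfolded (b zero)) ⟩
  closedForm b k ∎
  where
  plusVar = IsLiftPlusNewVar-resp-≗ (sym ∘ partialSumVars-fromℕ 0) (λ _ → refl) (allVars-plusNewVar 0)
  unfolded : ∀ x → x ≡ (x + 0ℚ) - 0ℚ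
  unfolded = solve-∀ ℚ-ring
theSeries≡closedForm (suc n) b k = begin
  theSeries b (tabulate k)                             ≡⟨ cong (theSeries b) (tabulate-∷ʳ k) ⟩
  theSeries b (tabulate (k ∘ inject₁) ∷ʳ k last)       ≡⟨ theSeries-lastCoeff n b (k last) (tabulate (k ∘ inject₁)) ⟩
  c * theSeries b′ (tabulate (k ∘ inject₁))            ≡⟨ cong (c *_) (theSeries≡closedForm n b′ (k ∘ inject₁)) ⟩
  c * closedForm b′ (k ∘ inject₁)                      ≡⟨ ℚ.*-comm c _ ⟩
  closedForm b′ (k ∘ inject₁) * c                      ≡⟨ closedForm-∷ʳ n b k ⟨
  closedForm b k                                       ∎
  where
  last = fromℕ (suc n)
  c = binom (b last) (k last)
  b′ = mergeLast b (k last)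

lemma1 : (n : ℕ) (b : Fin (suc n) → ℚ) (k : Fin (suc n) → ℕ) →
    b (fromℕ n) ≢ 0ℚ →
    theSeries b (tabulate k) ≡ closedForm b k
lemma1 n b k _ = theSeries≡closedForm n b k
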